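{- Let $R$ be a triple set that identifies the rooted tree $T$. Then every inclusion-minimal $R'\subseteq R$ with $\mathrm{cl}(R')=\mathrm{cl}(R)$ satisfies $|R'|=B(T)\in O(|L_R|^2)$.
   Context: A rooted tree $T=(V,E)$ has a distinguished inner vertex $\rho_T$ (root); leaves are degree-1 vertices; inner vertices other than the root have degree at least 3. For $v\in V$, $C(v)$ is the leaf set of the subtree rooted at $v$; $\mathcal C(T)=\{C(v):v\in V\}$; $T'$ refines $T$ if $\mathcal C(T)\subseteq\mathcal C(T')$. A triple $ab|c$ is the rooted binary tree on leaves $a,b,c$ where the path from $a$ to $b$ avoids the path from $c$ to the root; $ab|c=ba|c$. A rooted tree displays $ab|c$ if $a,b,c$ are leaves and the path from $a$ to $b$ does not intersect the path from $c$ to the root; $\mathcal R(T)$ is the set of displayed triples. $L_R$ is the set of leaves appearing in $R$. $\mathrm{cl}(R)=\bigcap\mathcal R(T')$ over all rooted trees $T'$ with leaf set $L_R$ displaying $R$. $R$ identifies $T$ if $T$ has leaf set $L_R$, displays $R$, and every rooted tree displaying $R$ refines $T$. With $c(v)$ the number of children of $v$ and $E^0$ the set of edges with both endpoints inner vertices, $B(T)=\sum_{(u,v)\in E^0}(c(u)-1)(c(v)-1)$. -}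

module Defs where

open import Data.Nat using (ℕ; zero; suc; _+_; _*_; _∸_; _<_; _≤_; _≟_)
open import Data.List using (List; []; _∷_; length; _++_; deduplicate)
open import Data.List.Membership.Propositional using (_∈_)
open import Data.List.Relation.Unary.All using (All)
open import Data.List.Relation.Unary.Unique.Propositional using (Unique)
open import Data.Product using (Σ; ∃; _×_; _,_)
open import Relation.Nullary using (¬_)
open import Relation.Binary.PropositionalEquality using (_≡_; _≢_)

-- Rooted trees with leaves labelled by natural numbers.
-- A vertex is represented by the subtree rooted at it.

data Tree : Set where
  leaf : ℕ → Tree
  node : List Tree → Tree

mutual
  leaves : Tree → List ℕ
  leaves (leaf x)  = x ∷ []
  leaves (node ts) = leavesL ts

  leavesL : List Tree → List ℕ
  leavesL []       = []
  leavesL (t ∷ ts) = leaves t ++ leavesL ts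

children : Tree → ℕ
children (leaf _)  = 0
children (node ts) = length ts

-- Non-root vertices: a leaf, or an inner vertex with ≥ 2 children (degree ≥ 3).
data NonRootWF : Tree → Set where
  leafWF : ∀ x → NonRootWF (leaf x)
  nodeWF : ∀ ts → 2 ≤ length ts → All NonRootWF ts → NonRootWF (node ts)

-- A rooted tree: the root is an inner vertex (so it is not a labelled leaf and
-- does not have exactly one child, since then it would have degree 1), every
-- non-root inner vertex has ≥ 2 children, and leaf labels are pairwise distinct.
IsTree : Tree → Set
IsTree T = Σ (List Tree) λ ts → T ≡ node ts × length ts ≢ 1 × All NonRootWF ts
           × Unique (leaves T)

data _≼_ : Tree → Tree → Set where
  here  : ∀ {t} → t ≼ t
  there : ∀ {s t ts} → t ∈ ts → s ≼ t → s ≼ node ts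

_≈ˢ_ : List ℕ → List ℕ → Set
xs ≈ˢ ys = ∀ x → (x ∈ xs → x ∈ ys) × (x ∈ ys → x ∈ xs)

Refines : Tree → Tree → Set
Refines T' T = ∀ v → v ≼ T → Σ Tree λ v' → v' ≼ T' × (leaves v ≈ˢ leaves v')

-- Triples.  ab|c is encoded as (a , b , c) with a < b (normal form, so that
-- ab|c = ba|c is a single element), a ≢ c, b ≢ c.

Triple : Set
Triple = ℕ × ℕ × ℕ

ValidTriple : Triple → Set
ValidTriple (a , b , c) = a < b × a ≢ c × b ≢ c

TripleSet : List Triple → Set
TripleSet R = All ValidTriple R × Unique R

-- T displays ab|c : a, b, c are leaves of T and the path a–b avoids the path
-- c–root, i.e. some vertex v has a, b ∈ C(v) and c ∉ C(v)
-- (v = lca(a,b) being such a vertex exactly when the paths are disjoint).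
Displays : Tree → Triple → Set
Displays T (a , b , c) =
  a ∈ leaves T × b ∈ leaves T × c ∈ leaves T ×
  Σ Tree λ v → v ≼ T × a ∈ leaves v × b ∈ leaves v × ¬ (c ∈ leaves v)

DisplaysAll : Tree → List Triple → Set
DisplaysAll T R = ∀ t → t ∈ R → Displays T t

labels : List Triple → List ℕ
labels []                = []
labels ((a , b , c) ∷ R) = a ∷ b ∷ c ∷ labels R

L : List Triple → List ℕ
L R = deduplicate _≟_ (labels R)

HasLeafSet : Tree → List Triple → Set
HasLeafSet T R = leaves T ≈ˢ L R

InCl : List Triple → Triple → Set
InCl R t = ∀ T' → IsTree T' → HasLeafSet T' R → DisplaysAll T' R → Displays T' t

SameCl : List Triple → List Triple → Set
SameCl R₁ R₂ = ∀ t → ValidTriple t → (InCl R₁ t → InCl R₂ t) × (InCl R₂ t → InCl R₁ t)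

Identifies : List Triple → Tree → Set
Identifies R T =
  IsTree T × HasLeafSet T R × DisplaysAll T R ×
  (∀ T' → IsTree T' → HasLeafSet T' R → DisplaysAll T' R → Refines T' T)

_⊆ᵗ_ : List Triple → List Triple → Set
R₁ ⊆ᵗ R₂ = ∀ t → t ∈ R₁ → t ∈ R₂

MinimalClosureSubset : List Triple → List Triple → Set
MinimalClosureSubset R R' =
  Unique R' × R' ⊆ᵗ R × SameCl R' R ×
  (∀ R'' → R'' ⊆ᵗ R' → SameCl R'' R → R' ⊆ᵗ R'')

-- B(T) = Σ_{(u,v) ∈ E⁰} (c(u) - 1)(c(v) - 1)

innerTerm : ℕ → Tree → ℕ
innerTerm cu (leaf _)  = 0
innerTerm cu (node ts) = (cu ∸ 1) * (length ts ∸ 1)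

mutual
  B : Tree → ℕ
  B (leaf _)  = 0
  B (node ts) = BL (length ts) ts

  -- contributions of the edges from a parent with cu children to the trees ts,
  -- plus everything inside ts
  BL : ℕ → List Tree → ℕ
  BL cu []       = 0
  BL cu (t ∷ ts) = innerTerm cu t + B t + BL cu ts

-- For an inner vertex u of T with distinct children w and s, the slot graph of (w, s) under a
-- triple set has the children of w as vertices, and an edge joining the children that contain a
-- and b for every triple ab|c with c below s.  A set R′ ⊆ R (R identifying T) has the closure of R
-- exactly when all slot graphs of R′ are connected.  Connectivity lets every tree displaying R′
-- rebuild the clusters of T from the top down, so it refines T; conversely, if the slot graph of
-- (w, s) is split by a colouring, regrouping the children of w by colour next to s gives a tree
-- that displays R′ but not a triple xy|z of T.  A triple ab|c displayed by T is an edge of exactly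
-- one slot graph, namely at lca(a, b, c), so for an inclusion-minimal R′ every slot graph is a
-- spanning tree: it has c(w) − 1 edges, and the c(u) − 1 siblings s of w give |R′| = B(T).
-- Finally (c(u) − 1) + n(v) ≤ n(u) for a child v of u, with n counting leaves, yields B(T) ≤ n(T)².

module Submission where

open import Defs
open import Data.Bool using (Bool; true; false; if_then_else_)
open import Data.Empty using (⊥; ⊥-elim)
open import Data.Fin using (Fin; zero; suc; punchIn; punchOut)
open import Data.Fin.Properties using (punchIn-punchOut; punchOut-punchIn; punchInᵢ≢i; punchOut-cong)
  renaming (_≟_ to _≟ᶠ_)
open import Data.List using (List; []; _∷_; _++_; length; lookup; map; mapMaybe; filter)
open import Data.List.Properties
  using ( length-map; length-++; length-++-sucʳ; length-∷=; map-++; mapMaybe-++; ∷-injective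
        ; ++-assoc; ++-identityʳ; filter-++ )
open import Data.List.Membership.Propositional using (_∈_; _∉_)
open import Data.List.Membership.Propositional.Properties
  using (∈-++⁺ˡ; ∈-++⁺ʳ; ∈-++⁻; ∈-lookup; ∈-∃++; ∈-filter⁺; ∈-filter⁻; ∈-deduplicate⁺; ∈-deduplicate⁻)
open import Data.List.Relation.Binary.Permutation.Propositional as ↭
  using (_↭_; prep; swap; ↭-refl; ↭-sym; ↭-trans; ↭-reflexive; ↭⇒↭ₛ)
open import Data.List.Relation.Binary.Permutation.Propositional.Properties
  using (∈-resp-↭; All-resp-↭; ↭-length; ++⁺; ++-comm; shift; ++⁺ˡ; ++⁺ʳ)
import Data.List.Relation.Binary.Permutation.Setoid.Properties as ↭ₛ
open import Data.List.Relation.Binary.Subset.Propositional using (_⊆_)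
open import Data.List.Relation.Unary.All as All using (All; []; _∷_)
open import Data.List.Relation.Unary.All.Properties using (anti-mono; ++⁻ˡ; ++⁻ʳ)
open import Data.List.Relation.Unary.AllPairs using ([]; _∷_)
open import Data.List.Relation.Unary.Any using (here; there; index; _∷=_)
open import Data.List.Relation.Unary.Any.Properties using (lookup-index)
open import Data.List.Relation.Unary.Unique.Propositional using (Unique)
open import Data.List.Relation.Unary.Unique.Propositional.Properties using (Unique[x∷xs]⇒x∉xs)
import Data.List.Relation.Unary.Unique.Propositional.Properties as Unique
open import Data.Maybe using (Maybe; just; nothing; zip; maybe′)
open import Data.Nat using (ℕ; zero; suc; _+_; _*_; _∸_; _≤_; _<?_; z≤n; s≤s; s≤s⁻¹; _≟_)
open import Data.Nat.Properties
  using ( ≤-antisym; ≤-trans; +-identityʳ; >⇒≢; <⇒≢; <-irrefl; ≤∧≢⇒<; ≮⇒≥; m∸n≤m; +-comm; *-zeroʳ; *-identityˡ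
        ; +-mono-≤; +-monoˡ-≤; *-monoʳ-≤; *-monoˡ-≤; *-distribˡ-+; *-distribʳ-+; module ≤-Reasoning
        ; +-0-commutativeMonoid; +-commutativeSemigroup )
open import Algebra.Properties.CommutativeMonoid.Sum +-0-commutativeMonoid
  using (sum; sum-syntax; sum-cong-≗; ∑-distrib-+; sum-remove; sum-replicate-zero)
open import Algebra.Properties.CommutativeSemigroup +-commutativeSemigroup
  using () renaming (interchange to +-interchange)
open import Data.List.Membership.DecPropositional _≟_ using (_∈?_)
open import Data.List.Relation.Unary.Unique.DecPropositional.Properties _≟_ using (deduplicate-!)
open import Data.Product using (Σ; ∃; ∃₂; _×_; _,_; proj₁; proj₂)
open import Data.Sum using (_⊎_; inj₁; inj₂; [_,_]′)
open import Function using (_∘_; _∘′_; id)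
open import Relation.Nullary using (¬_; Dec; yes; no; does)
open import Relation.Nullary.Decidable using (dec-true; dec-false)
open import Relation.Binary.PropositionalEquality
  using (_≡_; _≢_; refl; sym; trans; cong; cong₂; subst; subst₂; setoid; module ≡-Reasoning)


does≡true⇒ : ∀ {A : Set} (a? : Dec A) → does a? ≡ true → A
does≡true⇒ (yes a) _ = a

anotherIndex : ∀ {n} → n ≢ 1 → (i : Fin n) → Σ (Fin n) λ j → i ≢ j
anotherIndex {suc zero}    n≢1 _       = ⊥-elim (n≢1 refl)
anotherIndex {suc (suc n)} _   zero    = suc zero , λ ()
anotherIndex {suc (suc n)} _   (suc i) = zero , λ ()

⊆-or-outside : (xs ys : List ℕ) → xs ⊆ ys ⊎ ∃ λ z → z ∈ xs × z ∉ ys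
⊆-or-outside []       ys = inj₁ λ ()
⊆-or-outside (x ∷ xs) ys with x ∈? ys | ⊆-or-outside xs ys
... | no x∉                   | _                      = inj₂ (x , here refl , x∉)
... | yes x∈                  | inj₁ xs⊆               = inj₁ λ { (here refl) → x∈ ; (there z∈) → xs⊆ z∈ }
... | yes _                   | inj₂ (z , z∈ , z∉)     = inj₂ (z , there z∈ , z∉)

∈⇒↭∷ : ∀ {A : Set} {x : A} {xs} → x ∈ xs → ∃ λ ys → xs ↭ x ∷ ys
∈⇒↭∷ x∈ with ys , zs , refl ← ∈-∃++ x∈ = ys ++ zs , shift _ ys zs

Unique-++⁻ˡ : ∀ {A : Set} (xs : List A) {ys} → Unique (xs ++ ys) → Unique xs
Unique-++⁻ˡ []       _             = []
Unique-++⁻ˡ (x ∷ xs) (x∉ ∷ uniq)   = ++⁻ˡ xs x∉ ∷ Unique-++⁻ˡ xs uniq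

Unique-++⁻ʳ : ∀ {A : Set} (xs : List A) {ys} → Unique (xs ++ ys) → Unique ys
Unique-++⁻ʳ []       uniq       = uniq
Unique-++⁻ʳ (x ∷ xs) (_ ∷ uniq) = Unique-++⁻ʳ xs uniq

Unique-++-disjoint : ∀ {A : Set} (xs : List A) {ys z} → Unique (xs ++ ys) → z ∈ xs → z ∉ ys
Unique-++-disjoint (x ∷ xs) (x∉ ∷ _)    (here refl) z∈ys = All.lookup (++⁻ʳ xs x∉) z∈ys refl
Unique-++-disjoint (x ∷ xs) (_ ∷ uniq)  (there z∈)  z∈ys = Unique-++-disjoint xs uniq z∈ z∈ys

Unique-resp-↭ : ∀ {A : Set} {xs ys : List A} → xs ↭ ys → Unique xs → Unique ys
Unique-resp-↭ xs↭ys = ↭ₛ.Unique-resp-↭ (setoid _) (↭⇒↭ₛ xs↭ys)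

Unique-⊆⇒length≤ : ∀ {A : Set} {xs ys : List A} → Unique xs → xs ⊆ ys → length xs ≤ length ys
Unique-⊆⇒length≤ {xs = []}     _            _   = z≤n
Unique-⊆⇒length≤ {xs = x ∷ xs} (x∉ ∷ uniq) xs⊆ with rest , ys↭ ← ∈⇒↭∷ (xs⊆ (here refl)) =
  subst (suc (length xs) ≤_) (sym (↭-length ys↭)) (s≤s (Unique-⊆⇒length≤ uniq shrink))
  where
  shrink : xs ⊆ rest
  shrink y∈ with ∈-resp-↭ ys↭ (xs⊆ (there y∈))
  ... | here refl    = ⊥-elim (All.lookup x∉ y∈ refl)
  ... | there y∈rest = y∈rest

∈⇒1≤length : ∀ {A : Set} {x : A} {xs} → x ∈ xs → 1 ≤ length xs
∈⇒1≤length (here _)  = s≤s z≤n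
∈⇒1≤length (there _) = s≤s z≤n

map-split : ∀ {A B : Set} (g : A → B) (xs : List A) ys e zs → map g xs ≡ ys ++ e ∷ zs →
            ∃₂ λ xs₁ xs₂ → Σ A λ x → xs ≡ xs₁ ++ x ∷ xs₂ × map g xs₁ ≡ ys × map g xs₂ ≡ zs
map-split g (x ∷ xs) []       e zs eq with refl , eq′ ← ∷-injective eq = [] , xs , x , refl , refl , eq′
map-split g (x ∷ xs) (y ∷ ys) e zs eq with refl , eq′ ← ∷-injective eq
  with xs₁ , xs₂ , x′ , refl , refl , refl ← map-split g xs ys e zs eq′ = x ∷ xs₁ , xs₂ , x′ , refl , refl , refl

reinsert : ∀ {A : Set} (ys : List A) e zs xs₁ x xs₂ → ys ++ zs ≡ xs₁ ++ x ∷ xs₂ →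
           ∃₂ λ ws₁ ws₂ → ys ++ e ∷ zs ≡ ws₁ ++ x ∷ ws₂ × e ∈ ws₁ ++ ws₂ × xs₁ ++ xs₂ ⊆ ws₁ ++ ws₂
reinsert [] e zs xs₁ x xs₂ eq = e ∷ xs₁ , xs₂ , cong (e ∷_) eq , here refl , there
reinsert (y ∷ ys) e zs [] x xs₂ eq with refl , refl ← ∷-injective eq =
  [] , ys ++ e ∷ zs , refl , ∈-++⁺ʳ ys (here refl) , ∈-resp-↭ (↭-sym (shift e ys zs)) ∘′ there
reinsert (y ∷ ys) e zs (x₁ ∷ xs₁) x xs₂ eq with refl , eq′ ← ∷-injective eq
  with ws₁ , ws₂ , eq″ , e∈ , sub ← reinsert ys e zs xs₁ x xs₂ eq′ =
  y ∷ ws₁ , ws₂ , cong (y ∷_) eq″ , there e∈ , λ { (here refl) → here refl ; (there v∈) → there (sub v∈) }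

∈-mapMaybe⁻ : ∀ {A B : Set} (f : A → Maybe B) xs {y} → y ∈ mapMaybe f xs → Σ A λ x → x ∈ xs × f x ≡ just y
∈-mapMaybe⁻ f (x ∷ xs) y∈ with f x in fx | y∈
... | nothing | y∈xs           with x′ , x′∈ , fx′ ← ∈-mapMaybe⁻ f xs y∈xs = x′ , there x′∈ , fx′
... | just _  | here refl      = x , here refl , fx
... | just _  | there y∈xs     with x′ , x′∈ , fx′ ← ∈-mapMaybe⁻ f xs y∈xs = x′ , there x′∈ , fx′

∈-mapMaybe⁺ : ∀ {A B : Set} (f : A → Maybe B) {xs x y} → x ∈ xs → f x ≡ just y → y ∈ mapMaybe f xs
∈-mapMaybe⁺ f {x ∷ _} (here refl) fx≡ with f x
∈-mapMaybe⁺ f         (here refl) refl | just _ = here refl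
∈-mapMaybe⁺ f {x ∷ _} (there x∈)  fx≡ with f x
... | nothing = ∈-mapMaybe⁺ f x∈ fx≡
... | just _  = there (∈-mapMaybe⁺ f x∈ fx≡)

All-mapMaybe⁺ : ∀ {A B : Set} {P : B → Set} (f : A → Maybe B) xs →
                (∀ {x y} → x ∈ xs → f x ≡ just y → P y) → All P (mapMaybe f xs)
All-mapMaybe⁺ f xs hyp = All.tabulate λ y∈ → let _ , x∈ , fx≡ = ∈-mapMaybe⁻ f xs y∈ in hyp x∈ fx≡

mapMaybe-split : ∀ {A B : Set} (f : A → Maybe B) xs ys e zs → mapMaybe f xs ≡ ys ++ e ∷ zs →
  ∃₂ λ xs₁ xs₂ → Σ A λ x → xs ≡ xs₁ ++ x ∷ xs₂ × mapMaybe f xs₁ ≡ ys × f x ≡ just e × mapMaybe f xs₂ ≡ zs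
mapMaybe-split f []       []      _ _ ()
mapMaybe-split f []       (_ ∷ _) _ _ ()
mapMaybe-split f (x ∷ xs) ys e zs eq with f x in fx
... | nothing with xs₁ , xs₂ , x′ , refl , refl , fx′ , refl ← mapMaybe-split f xs ys e zs eq =
  x ∷ xs₁ , xs₂ , x′ , refl , skip , fx′ , refl
  where
  skip : mapMaybe f (x ∷ xs₁) ≡ mapMaybe f xs₁
  skip rewrite fx = refl
mapMaybe-split f (x ∷ xs) [] e zs eq | just y with refl , refl ← ∷-injective eq = [] , xs , x , refl , refl , fx , refl
mapMaybe-split f (x ∷ xs) (y′ ∷ ys) e zs eq | just y
  with refl , eq′ ← ∷-injective eq
  with xs₁ , xs₂ , x′ , refl , refl , fx′ , refl ← mapMaybe-split f xs ys e zs eq′ =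
  x ∷ xs₁ , xs₂ , x′ , refl , emit , fx′ , refl
  where
  emit : mapMaybe f (x ∷ xs₁) ≡ y ∷ mapMaybe f xs₁
  emit rewrite fx = refl

mapMaybe-drop : ∀ {A B : Set} (f : A → Maybe B) xs {x} ys → f x ≡ nothing →
                mapMaybe f (xs ++ x ∷ ys) ≡ mapMaybe f (xs ++ ys)
mapMaybe-drop f xs {x} ys fx≡ =
  trans (mapMaybe-++ f xs (x ∷ ys)) (trans (cong (mapMaybe f xs ++_) skip) (sym (mapMaybe-++ f xs ys)))
  where
  skip : mapMaybe f (x ∷ ys) ≡ mapMaybe f ys
  skip rewrite fx≡ = refl

∈-∷=-updated : ∀ {A : Set} {t : A} {ts x} (t∈ : t ∈ ts) → x ∈ (t∈ ∷= x)
∈-∷=-updated (here _)  = here refl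
∈-∷=-updated (there p) = there (∈-∷=-updated p)

∈-∷=-untouched : ∀ {A : Set} {t t′ : A} {ts x} (t∈ : t ∈ ts) → t′ ∈ ts → t′ ≡ t ⊎ t′ ∈ (t∈ ∷= x)
∈-∷=-untouched (here refl) (here refl) = inj₁ refl
∈-∷=-untouched (here _)    (there t′∈) = inj₂ (there t′∈)
∈-∷=-untouched (there _)   (here t′≡)  = inj₂ (here t′≡)
∈-∷=-untouched (there t∈)  (there t′∈) with ∈-∷=-untouched t∈ t′∈
... | inj₁ t′≡t = inj₁ t′≡t
... | inj₂ t′∈′ = inj₂ (there t′∈′)


sum-zero : ∀ {n} (f : Fin n → ℕ) → (∀ i → f i ≡ 0) → sum f ≡ 0
sum-zero {n} f f≡0 = trans (sum-cong-≗ f≡0) (sum-replicate-zero n)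

sum-single : ∀ {n} (f : Fin n → ℕ) k → (∀ i → i ≢ k → f i ≡ 0) → sum f ≡ f k
sum-single {suc n} f k f≡0 = begin
  sum f                         ≡⟨ sum-remove {i = k} f ⟩
  f k + sum (f ∘ punchIn k)     ≡⟨ cong (f k +_) (sum-zero (f ∘ punchIn k) (λ j → f≡0 (punchIn k j) (punchInᵢ≢i k j))) ⟩
  f k + 0                       ≡⟨ +-identityʳ (f k) ⟩
  f k                           ∎
  where open ≡-Reasoning

sum-const : ∀ n c → sum {n} (λ _ → c) ≡ n * c
sum-const zero    c = refl
sum-const (suc n) c = cong (c +_) (sum-const n c)

sum-skip : ∀ {n} (i : Fin n) c → ∑[ j < n ] (if does (i ≟ᶠ j) then 0 else c) ≡ (n ∸ 1) * c
sum-skip {suc n} i c = begin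
  ∑[ j < suc n ] f j              ≡⟨ sum-remove {i = i} f ⟩
  f i + sum (f ∘ punchIn i)       ≡⟨ cong₂ _+_ (cong (λ b → if b then 0 else c) (dec-true (i ≟ᶠ i) refl))
                                               (sum-cong-≗ λ j → cong (λ b → if b then 0 else c)
                                                                   (dec-false (i ≟ᶠ punchIn i j) (punchInᵢ≢i i j ∘ sym))) ⟩
  0 + ∑[ j < n ] c                ≡⟨ sum-const n c ⟩
  n * c                           ∎
  where
  open ≡-Reasoning
  f : Fin (suc n) → ℕ
  f j = if does (i ≟ᶠ j) then 0 else c


-- Connectivity of multigraphs

-- Multigraphs on Fin m are lists of edges, loops and parallel edges allowed; connectivity is
-- phrased through cuts.
Edge : ℕ → Set
Edge m = Fin m × Fin m

Uncut : ∀ {m} → (Fin m → Bool) → List (Edge m) → Set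
Uncut S = All λ e → S (proj₁ e) ≡ S (proj₂ e)

Connected : (m : ℕ) → List (Edge m) → Set
Connected m E = ∀ (S : Fin m → Bool) → Uncut S E → ∀ p q → S p ≡ S q

MinimallyConnected : (m : ℕ) → List (Edge m) → Set
MinimallyConnected m E =
  Connected m E × (∀ ys e zs → E ≡ ys ++ e ∷ zs → ¬ Connected m (ys ++ zs))

Connected-shift : ∀ {m} ys (e : Edge m) zs → Connected m (ys ++ e ∷ zs) → Connected m (e ∷ ys ++ zs)
Connected-shift ys e zs conn S unc = conn S (anti-mono (∈-resp-↭ (shift e ys zs)) unc)

CutEdge : ∀ {m} → (Fin m → Bool) → List (Edge m) → Set
CutEdge S E = ∃₂ λ ys zs → Σ (Edge _) λ e → E ≡ ys ++ e ∷ zs × S (proj₁ e) ≢ S (proj₂ e)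

uncut-or-cutEdge : ∀ {m} (S : Fin m → Bool) E → Uncut S E ⊎ CutEdge S E
uncut-or-cutEdge S [] = inj₁ []
uncut-or-cutEdge S ((p , q) ∷ E) with S p Data.Bool.≟ S q | uncut-or-cutEdge S E
... | no Sp≢Sq | _                                  = inj₂ ([] , E , (p , q) , refl , Sp≢Sq)
... | yes Sp≡Sq | inj₁ unc                          = inj₁ (Sp≡Sq ∷ unc)
... | yes _     | inj₂ (ys , zs , e , refl , cut)   = inj₂ ((p , q) ∷ ys , zs , e , refl , cut)

isZero : ∀ {m} → Fin m → Bool
isZero zero    = true
isZero (suc _) = false

ProperEdgeSplit : ∀ m → List (Edge m) → Set
ProperEdgeSplit m E = ∃₂ λ ys zs → Σ (Edge m) λ e → E ≡ ys ++ e ∷ zs × proj₁ e ≢ proj₂ e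

properEdge : ∀ {m} {E : List (Edge (suc (suc m)))} → Connected (suc (suc m)) E → ProperEdgeSplit _ E
properEdge {E = E} conn with uncut-or-cutEdge isZero E
... | inj₁ unc                          with () ← conn isZero unc zero (suc zero)
... | inj₂ (ys , zs , e , E≡ , cut)     = ys , zs , e , E≡ , λ p≡q → cut (cong isZero p≡q)

Connected⇒incident : ∀ {m} {E : List (Edge m)} → Connected m E → ∀ p q → p ≢ q →
                     Σ (Edge m) λ e → e ∈ E × (proj₁ e ≡ p ⊎ proj₂ e ≡ p)
Connected⇒incident {E = E} conn p q p≢q with uncut-or-cutEdge (λ r → does (r ≟ᶠ p)) E
... | inj₁ unc
  with () ← trans (sym (dec-true (p ≟ᶠ p) refl)) (trans (conn _ unc p q) (dec-false (q ≟ᶠ p) (p≢q ∘ sym)))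
... | inj₂ (ys , zs , (r₁ , r₂) , refl , cut) = (r₁ , r₂) , ∈-++⁺ʳ ys (here refl) , touches
  where
  touches : r₁ ≡ p ⊎ r₂ ≡ p
  touches with r₁ ≟ᶠ p | r₂ ≟ᶠ p
  ... | yes r₁≡p | _        = inj₁ r₁≡p
  ... | no _     | yes r₂≡p = inj₂ r₂≡p
  ... | no _     | no _     = ⊥-elim (cut refl)

module Contraction {m : ℕ} (a b : Fin (suc m)) (a≢b : a ≢ b) where

  contract : Fin (suc m) → Fin m
  contract x with x ≟ᶠ a
  ... | yes _   = punchOut a≢b
  ... | no x≢a  = punchOut (λ a≡x → x≢a (sym a≡x))

  contract-punchIn : ∀ p → contract (punchIn a p) ≡ p
  contract-punchIn p with punchIn a p ≟ᶠ a
  ... | yes p≡a = ⊥-elim (punchInᵢ≢i a p p≡a)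
  ... | no _    = trans (punchOut-cong a refl) (punchOut-punchIn a)

  contract-a≡b : contract a ≡ contract b
  contract-a≡b with a ≟ᶠ a | b ≟ᶠ a
  ... | no a≢a | _       = ⊥-elim (a≢a refl)
  ... | yes _  | yes b≡a = ⊥-elim (a≢b (sym b≡a))
  ... | yes _  | no _    = punchOut-cong a refl

  punchIn-contract : ∀ (S : Fin (suc m) → Bool) → S a ≡ S b → ∀ x → S (punchIn a (contract x)) ≡ S x
  punchIn-contract S Sa≡Sb x with x ≟ᶠ a
  ... | yes refl = trans (cong S (punchIn-punchOut a≢b)) (sym Sa≡Sb)
  ... | no _     = cong S (punchIn-punchOut _)

  contractEdge : Edge (suc m) → Edge m
  contractEdge (x , y) = contract x , contract y

  Connected-contract : ∀ E → Connected (suc m) ((a , b) ∷ E) → Connected m (map contractEdge E)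
  Connected-contract E conn S unc p q =
    trans (cong S (sym (contract-punchIn p)))
      (trans (conn (λ x → S (contract x)) (cong S contract-a≡b ∷ pull E unc) (punchIn a p) (punchIn a q))
        (cong S (contract-punchIn q)))
    where
    pull : ∀ E → Uncut S (map contractEdge E) → Uncut (λ x → S (contract x)) E
    pull []      []          = []
    pull (_ ∷ E) (u ∷ unc)   = u ∷ pull E unc

  uncut-uncontract : ∀ E (S : Fin (suc m) → Bool) → S a ≡ S b → Uncut S E →
                     Connected m (map contractEdge E) → ∀ p q → S p ≡ S q
  uncut-uncontract E S Sa≡Sb unc conn p q =
    trans (sym (punchIn-contract S Sa≡Sb p))
      (trans (conn (λ y → S (punchIn a y)) (push E unc) (contract p) (contract q))
        (punchIn-contract S Sa≡Sb q))
    where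
    push : ∀ E → Uncut S E → Uncut (λ y → S (punchIn a y)) (map contractEdge E)
    push []             []        = []
    push ((x , y) ∷ E)  (u ∷ unc) =
      trans (punchIn-contract S Sa≡Sb x) (trans u (sym (punchIn-contract S Sa≡Sb y))) ∷ push E unc

-- Both edge bounds contract a non-loop edge, which exists once there are two vertices.
Connected⇒≤1+length : ∀ m (E : List (Edge m)) → Connected m E → m ≤ suc (length E)
contractProperEdge : ∀ m (E : List (Edge (suc m))) → Connected (suc m) E → ProperEdgeSplit (suc m) E →
                     suc m ≤ suc (length E)
Connected⇒≤1+length zero          E conn = z≤n
Connected⇒≤1+length (suc zero)    E conn = s≤s z≤n
Connected⇒≤1+length (suc (suc m)) E conn = contractProperEdge (suc m) E conn (properEdge conn)
contractProperEdge m E conn (ys , zs , (a , b) , refl , a≢b) =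
  subst (λ k → suc m ≤ suc k) (sym (length-++-sucʳ ys (a , b) zs))
    (s≤s (subst (λ k → m ≤ suc k) (length-map contractEdge (ys ++ zs))
      (Connected⇒≤1+length m (map contractEdge (ys ++ zs))
        (Connected-contract (ys ++ zs) (Connected-shift ys (a , b) zs conn)))))
  where open Contraction a b a≢b

MinimallyConnected⇒length≤ : ∀ m (E : List (Edge (suc m))) → MinimallyConnected (suc m) E → length E ≤ m
MinimallyConnected⇒length≤ zero    []      _             = z≤n
MinimallyConnected⇒length≤ zero    (e ∷ E) (_ , minimal) =
  ⊥-elim (minimal [] e E refl λ { S _ zero zero → refl })
MinimallyConnected⇒length≤ (suc m) E       (conn , minimal) with properEdge conn
... | ys , zs , (a , b) , refl , a≢b rewrite length-++-sucʳ ys (a , b) zs =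
  s≤s (subst (_≤ m) (length-map contractEdge (ys ++ zs))
        (MinimallyConnected⇒length≤ m E′ (conn′ , minimal′)))
  where
  open Contraction a b a≢b
  E′ : List (Edge (suc m))
  E′ = map contractEdge (ys ++ zs)
  conn′ : Connected (suc m) E′
  conn′ = Connected-contract (ys ++ zs) (Connected-shift ys (a , b) zs conn)
  minimal′ : ∀ ys′ e′ zs′ → E′ ≡ ys′ ++ e′ ∷ zs′ → ¬ Connected (suc m) (ys′ ++ zs′)
  minimal′ ys′ e′ zs′ eq conn″
    with xs₁ , xs₂ , x , eq₁ , refl , refl ← map-split contractEdge (ys ++ zs) ys′ e′ zs′ eq
    with ws₁ , ws₂ , eq₂ , ab∈ , sub ← reinsert ys (a , b) zs xs₁ x xs₂ eq₁ =
    minimal ws₁ x ws₂ eq₂ λ S unc →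
      uncut-uncontract (xs₁ ++ xs₂) S (All.lookup unc ab∈) (anti-mono sub unc)
        (subst (Connected (suc m)) (sym (map-++ contractEdge xs₁ xs₂)) conn″)

MinimallyConnected⇒length≡ : ∀ m (E : List (Edge m)) → MinimallyConnected m E → length E ≡ m ∸ 1
MinimallyConnected⇒length≡ zero    []  _    = refl
MinimallyConnected⇒length≡ zero    ((() , _) ∷ _)
MinimallyConnected⇒length≡ (suc m) E   mc   =
  ≤-antisym (MinimallyConnected⇒length≤ m E mc) (s≤s⁻¹ (Connected⇒≤1+length (suc m) E (proj₁ mc)))


Tree-ind : (P : Tree → Set) → (∀ x → P (leaf x)) → (∀ ts → (∀ i → P (lookup ts i)) → P (node ts)) → ∀ t → P t
Tree-ind P leaf-case node-case = go
  where
  go : ∀ t → P t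
  goL : ∀ ts i → P (lookup ts i)
  go (leaf x)  = leaf-case x
  go (node ts) = node-case ts (goL ts)
  goL (t ∷ ts) zero    = go t
  goL (t ∷ ts) (suc i) = goL ts i

∈-leavesL⁺ : ∀ {t ts x} → t ∈ ts → x ∈ leaves t → x ∈ leavesL ts
∈-leavesL⁺ {ts = t ∷ ts}  (here refl) x∈ = ∈-++⁺ˡ x∈
∈-leavesL⁺ {ts = t ∷ ts}  (there t∈)  x∈ = ∈-++⁺ʳ (leaves t) (∈-leavesL⁺ t∈ x∈)

∈-leavesL-lookup⁺ : ∀ ts i {x} → x ∈ leaves (lookup ts i) → x ∈ leavesL ts
∈-leavesL-lookup⁺ ts i = ∈-leavesL⁺ (∈-lookup {xs = ts} i)

∈-leavesL⁻ : ∀ ts {x} → x ∈ leavesL ts → Σ (Fin (length ts)) λ i → x ∈ leaves (lookup ts i)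
∈-leavesL⁻ (t ∷ ts) x∈ with ∈-++⁻ (leaves t) x∈
... | inj₁ x∈t  = zero , x∈t
... | inj₂ x∈ts with i , x∈ti ← ∈-leavesL⁻ ts x∈ts = suc i , x∈ti

leavesL-++ : ∀ ts ts′ → leavesL (ts ++ ts′) ≡ leavesL ts ++ leavesL ts′
leavesL-++ []       ts′ = refl
leavesL-++ (t ∷ ts) ts′ = trans (cong (leaves t ++_) (leavesL-++ ts ts′)) (sym (++-assoc (leaves t) _ _))

leavesL-↭ : ∀ {ts ts′} → ts ↭ ts′ → leavesL ts ↭ leavesL ts′
leavesL-↭ ↭.refl         = ↭-refl
leavesL-↭ (prep t p)     = ++⁺ˡ (leaves t) (leavesL-↭ p)
leavesL-↭ {t ∷ t′ ∷ ts} {_ ∷ _ ∷ ts′} (swap _ _ p) =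
  ↭-trans (↭-reflexive (sym (++-assoc (leaves t) (leaves t′) (leavesL ts))))
    (↭-trans (++⁺ (++-comm (leaves t) (leaves t′)) (leavesL-↭ p))
      (↭-reflexive (++-assoc (leaves t′) (leaves t) (leavesL ts′))))
leavesL-↭ (↭.trans p q) = ↭-trans (leavesL-↭ p) (leavesL-↭ q)

Unique-leavesL-child : ∀ {t} ts → t ∈ ts → Unique (leavesL ts) → Unique (leaves t)
Unique-leavesL-child (t ∷ ts)  (here refl) uniq = Unique-++⁻ˡ (leaves t) uniq
Unique-leavesL-child (t′ ∷ ts) (there t∈)  uniq = Unique-leavesL-child ts t∈ (Unique-++⁻ʳ (leaves t′) uniq)

Unique-leavesL⇒index≡ : ∀ ts {i j x} → Unique (leavesL ts) →
                        x ∈ leaves (lookup ts i) → x ∈ leaves (lookup ts j) → i ≡ j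
Unique-leavesL⇒index≡ (t ∷ ts) {zero}  {zero}  uniq _   _   = refl
Unique-leavesL⇒index≡ (t ∷ ts) {zero}  {suc j} uniq x∈i x∈j =
  ⊥-elim (Unique-++-disjoint (leaves t) uniq x∈i (∈-leavesL-lookup⁺ ts j x∈j))
Unique-leavesL⇒index≡ (t ∷ ts) {suc i} {zero}  uniq x∈i x∈j =
  ⊥-elim (Unique-++-disjoint (leaves t) uniq x∈j (∈-leavesL-lookup⁺ ts i x∈i))
Unique-leavesL⇒index≡ (t ∷ ts) {suc i} {suc j} uniq x∈i x∈j =
  cong suc (Unique-leavesL⇒index≡ ts (Unique-++⁻ʳ (leaves t) uniq) x∈i x∈j)

Unique-leavesL⇒≡ : ∀ ts {t₁ t₂ x} → Unique (leavesL ts) → t₁ ∈ ts → t₂ ∈ ts →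
                   x ∈ leaves t₁ → x ∈ leaves t₂ → t₁ ≡ t₂
Unique-leavesL⇒≡ ts uniq t₁∈ t₂∈ x∈₁ x∈₂ =
  trans (lookup-index t₁∈) (trans (cong (lookup ts) (Unique-leavesL⇒index≡ ts uniq (at t₁∈ x∈₁) (at t₂∈ x∈₂)))
                                   (sym (lookup-index t₂∈)))
  where
  at : ∀ {t x} (t∈ : t ∈ ts) → x ∈ leaves t → x ∈ leaves (lookup ts (index t∈))
  at t∈ = subst (λ t → _ ∈ leaves t) (lookup-index t∈)

leaf-∈ : ∀ {x y} → x ∈ leaves (leaf y) → x ≡ y
leaf-∈ (here x≡y) = x≡y

child-≼ : ∀ {t ts} → t ∈ ts → t ≼ node ts
child-≼ t∈ = there t∈ here

lookup-≼ : ∀ ts i → lookup ts i ≼ node ts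
lookup-≼ ts i = child-≼ (∈-lookup {xs = ts} i)

≼-trans : ∀ {r s t} → r ≼ s → s ≼ t → r ≼ t
≼-trans r≼s here          = r≼s
≼-trans r≼s (there t∈ s≼) = there t∈ (≼-trans r≼s s≼)

≼-leaves : ∀ {s t x} → s ≼ t → x ∈ leaves s → x ∈ leaves t
≼-leaves here          x∈ = x∈
≼-leaves (there t∈ s≼) x∈ = ∈-leavesL⁺ t∈ (≼-leaves s≼ x∈)

≼-Unique : ∀ {s t} → s ≼ t → Unique (leaves t) → Unique (leaves s)
≼-Unique here                    uniq = uniq
≼-Unique (there {ts = ts} t∈ s≼) uniq = ≼-Unique s≼ (Unique-leavesL-child ts t∈ uniq)

≼-node⁻ : ∀ {s ts} → s ≼ node ts → s ≡ node ts ⊎ Σ (Fin (length ts)) λ k → s ≼ lookup ts k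
≼-node⁻ here          = inj₁ refl
≼-node⁻ (there t∈ s≼) = inj₂ (index t∈ , subst (_ ≼_) (lookup-index t∈) s≼)

≼-laminar : ∀ {t s d x} → Unique (leaves t) → s ≼ t → d ≼ t → x ∈ leaves s → x ∈ leaves d → s ≼ d ⊎ d ≼ s
≼-laminar uniq here          d≼             _    _    = inj₂ d≼
≼-laminar uniq (there t∈ s≼) here           _    _    = inj₁ (there t∈ s≼)
≼-laminar {node ts} uniq (there t∈ s≼) (there t′∈ d≼) x∈s x∈d
  with refl ← Unique-leavesL⇒≡ ts uniq t∈ t′∈ (≼-leaves s≼ x∈s) (≼-leaves d≼ x∈d) =
  ≼-laminar (Unique-leavesL-child ts t∈ uniq) s≼ d≼ x∈s x∈d

Separates : Tree → Triple → Set
Separates v (a , b , c) = a ∈ leaves v × b ∈ leaves v × c ∉ leaves v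

separated-inside-child : ∀ {T ds a b c} → Unique (leaves T) → node ds ≼ T →
  (Σ Tree λ v → v ≼ T × Separates v (a , b , c)) → a ∈ leavesL ds → c ∈ leavesL ds →
  Σ (Fin (length ds)) λ k → a ∈ leaves (lookup ds k) × b ∈ leaves (lookup ds k)
separated-inside-child uniq d≼T (v , v≼T , a∈v , b∈v , c∉v) a∈d c∈d with ≼-laminar uniq v≼T d≼T a∈v a∈d
... | inj₂ d≼v = ⊥-elim (c∉v (≼-leaves d≼v c∈d))
... | inj₁ v≼d with ≼-node⁻ v≼d
...   | inj₁ refl      = ⊥-elim (c∉v c∈d)
...   | inj₂ (k , v≼k) = k , ≼-leaves v≼k a∈v , ≼-leaves v≼k b∈v

Refines-Displays : ∀ {T T′} → Refines T′ T → leaves T ⊆ leaves T′ → ∀ t → Displays T t → Displays T′ t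
Refines-Displays refines T⊆T′ (a , b , c) (a∈ , b∈ , c∈ , v , v≼T , a∈v , b∈v , c∉v)
  with v′ , v′≼T′ , v≈v′ ← refines v v≼T =
  T⊆T′ a∈ , T⊆T′ b∈ , T⊆T′ c∈ , v′ , v′≼T′ , proj₁ (v≈v′ a) a∈v , proj₁ (v≈v′ b) b∈v , c∉v ∘ proj₂ (v≈v′ c)

NonRootWF⇒leaf : ∀ {t} → NonRootWF t → ∃ λ x → x ∈ leaves t
NonRootWF⇒leaf (leafWF x)                     = x , here refl
NonRootWF⇒leaf (nodeWF (t ∷ ts) _ (wf ∷ _)) with x , x∈ ← NonRootWF⇒leaf wf = x , ∈-++⁺ˡ x∈

NonRootWF-children : ∀ {t us} → NonRootWF t → node us ≼ t → All NonRootWF us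
NonRootWF-children (nodeWF _ _ wfs) here          = wfs
NonRootWF-children (nodeWF _ _ wfs) (there t∈ u≼) = NonRootWF-children (All.lookup wfs t∈) u≼

NonRootWF-≥2 : ∀ {t us} → NonRootWF t → node us ≼ t → 2 ≤ length us
NonRootWF-≥2 (nodeWF _ ≥2 _)   here          = ≥2
NonRootWF-≥2 (nodeWF _ _  wfs) (there t∈ u≼) = NonRootWF-≥2 (All.lookup wfs t∈) u≼

IsTree-children : ∀ {T us} → IsTree T → node us ≼ T → All NonRootWF us
IsTree-children (_ , refl , _ , wfs , _) here          = wfs
IsTree-children (_ , refl , _ , wfs , _) (there t∈ u≼) = NonRootWF-children (All.lookup wfs t∈) u≼

IsTree-≢1 : ∀ {T us} → IsTree T → node us ≼ T → length us ≢ 1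
IsTree-≢1 (_ , refl , ≢1 , _   , _) here          = ≢1
IsTree-≢1 (_ , refl , _  , wfs , _) (there t∈ u≼) = >⇒≢ (NonRootWF-≥2 (All.lookup wfs t∈) u≼)

IsTree-Unique : ∀ {T s} → IsTree T → s ≼ T → Unique (leaves s)
IsTree-Unique (_ , refl , _ , _ , uniq) s≼ = ≼-Unique s≼ uniq

IsTree-child : ∀ {T us} → IsTree T → node us ≼ T → ∀ i → NonRootWF (lookup us i)
IsTree-child {us = us} isT u≼ i = All.lookup (IsTree-children isT u≼) (∈-lookup {xs = us} i)

IsTree-lookup-injective : ∀ {T us} → IsTree T → node us ≼ T → ∀ i j → i ≢ j → lookup us i ≢ lookup us j
IsTree-lookup-injective {us = us} isT u≼ i j i≢j eq with x , x∈ ← NonRootWF⇒leaf (IsTree-child isT u≼ i) =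
  i≢j (Unique-leavesL⇒index≡ us (IsTree-Unique isT u≼) x∈ (subst (λ v → x ∈ leaves v) eq x∈))

IsTree⇒empty⊎NonRootWF : ∀ {T} → IsTree T → T ≡ node [] ⊎ NonRootWF T
IsTree⇒empty⊎NonRootWF ([]          , refl , _   , _   , _) = inj₁ refl
IsTree⇒empty⊎NonRootWF (_ ∷ []      , refl , ≢1  , _   , _) = ⊥-elim (≢1 refl)
IsTree⇒empty⊎NonRootWF (_ ∷ _ ∷ _   , refl , _   , wfs , _) = inj₂ (nodeWF _ (s≤s (s≤s z≤n)) wfs)

childList : Tree → List Tree
childList (leaf _)  = []
childList (node ts) = ts

children≡ : ∀ w → children w ≡ length (childList w)
children≡ (leaf _) = refl
children≡ (node _) = refl

∈-childList⇒∈ : ∀ w p {x} → x ∈ leaves (lookup (childList w) p) → x ∈ leaves w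
∈-childList⇒∈ (node ws) p = ∈-leavesL-lookup⁺ ws p


-- Slot graphs

childIndex : (ts : List Tree) → ℕ → Maybe (Fin (length ts))
childIndex []       x = nothing
childIndex (t ∷ ts) x with x ∈? leaves t
... | yes _ = just zero
... | no _  = Data.Maybe.map suc (childIndex ts x)

childIndex-sound : ∀ ts {x i} → childIndex ts x ≡ just i → x ∈ leaves (lookup ts i)
childIndex-sound (t ∷ ts) {x} eq with x ∈? leaves t
childIndex-sound (t ∷ ts) refl | yes x∈ = x∈
... | no _ with childIndex ts x in eq′
childIndex-sound (t ∷ ts) refl | no _ | just i = childIndex-sound ts eq′

childIndex-complete : ∀ ts {x i} → Unique (leavesL ts) → x ∈ leaves (lookup ts i) → childIndex ts x ≡ just i
childIndex-complete ts {x} {i} uniq x∈ = found (exists ts i x∈)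
  where
  exists : ∀ ts i → x ∈ leaves (lookup ts i) → Σ (Fin (length ts)) λ j → childIndex ts x ≡ just j
  exists (t ∷ ts) i x∈ with x ∈? leaves t
  ... | yes _ = zero , refl
  exists (t ∷ ts) zero    x∈ | no x∉ = ⊥-elim (x∉ x∈)
  exists (t ∷ ts) (suc i) x∈ | no _ with childIndex ts x | exists ts i x∈
  ... | just j | _ = suc j , refl
  found : (Σ (Fin (length ts)) λ j → childIndex ts x ≡ just j) → childIndex ts x ≡ just i
  found (j , eq) with refl ← Unique-leavesL⇒index≡ ts uniq (childIndex-sound ts eq) x∈ = eq

slotEdge : (w s : Tree) → Triple → Maybe (Edge (length (childList w)))
slotEdge w s (a , b , c) =
  if does (c ∈? leaves s) then zip (childIndex (childList w) a) (childIndex (childList w) b) else nothing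

slotEdge-just⁻ : ∀ w s a b c {p q} → slotEdge w s (a , b , c) ≡ just (p , q) →
                 c ∈ leaves s × a ∈ leaves (lookup (childList w) p) × b ∈ leaves (lookup (childList w) q)
slotEdge-just⁻ w s a b c eq with c ∈? leaves s | childIndex (childList w) a in ea | childIndex (childList w) b in eb
slotEdge-just⁻ w s a b c refl | yes c∈ | just _ | just _ =
  c∈ , childIndex-sound (childList w) ea , childIndex-sound (childList w) eb

slotEdge-just⁺ : ∀ w s a b c {p q} → Unique (leavesL (childList w)) → c ∈ leaves s →
                 a ∈ leaves (lookup (childList w) p) → b ∈ leaves (lookup (childList w) q) →
                 slotEdge w s (a , b , c) ≡ just (p , q)
slotEdge-just⁺ w s a b c uniq c∈ a∈ b∈ with c ∈? leaves s
... | no c∉ = ⊥-elim (c∉ c∈)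
... | yes _ rewrite childIndex-complete (childList w) uniq a∈ | childIndex-complete (childList w) uniq b∈ = refl

slotGraph : (w s : Tree) → List Triple → List (Edge (length (childList w)))
slotGraph w s = mapMaybe (slotEdge w s)

SlotsConnected : Tree → List Triple → Set
SlotsConnected T R = ∀ us → node us ≼ T → ∀ i j → i ≢ j →
  Connected (length (childList (lookup us i))) (slotGraph (lookup us i) (lookup us j) R)

SlotsConnected-inner : ∀ {T} R → SlotsConnected T R → ∀ {us} → node us ≼ T → ∀ i j → i ≢ j →
  ∀ {ws} → lookup us i ≡ node ws → Connected (length ws) (slotGraph (node ws) (lookup us j) R)
SlotsConnected-inner R slotsConn {us} u≼T i j i≢j i≡w =
  subst (λ v → Connected (length (childList v)) (slotGraph v (lookup us j) R)) i≡w (slotsConn us u≼T i j i≢j)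

slotEdge-just⇒∈ : ∀ w s a b c {e} → slotEdge w s (a , b , c) ≡ just e → a ∈ leaves w × c ∈ leaves s
slotEdge-just⇒∈ w s a b c {p , q} eq with c∈s , a∈p , _ ← slotEdge-just⁻ w s a b c eq = ∈-childList⇒∈ w p a∈p , c∈s

slot-nested : ∀ {us us₂ a c i j i₂ j₂} → Unique (leavesL us₂) → node us ≼ node us₂ → i₂ ≢ j₂ →
  a ∈ leaves (lookup us i) → c ∈ leaves (lookup us j) → a ∈ leaves (lookup us₂ i₂) → c ∈ leaves (lookup us₂ j₂) →
  lookup us₂ i₂ ≡ lookup us i × lookup us₂ j₂ ≡ lookup us j
slot-nested {us} {us₂} uniq u≼u₂ i₂≢j₂ a∈i c∈j a∈i₂ c∈j₂ with ≼-node⁻ u≼u₂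
... | inj₁ refl
  with refl ← Unique-leavesL⇒index≡ us uniq a∈i a∈i₂
  with refl ← Unique-leavesL⇒index≡ us uniq c∈j c∈j₂ = refl , refl
... | inj₂ (k , u≼k) = ⊥-elim (i₂≢j₂ (trans (index≡ a∈i₂ (inside a∈i)) (index≡ (inside c∈j) c∈j₂)))
  where
  index≡ : ∀ {i j x} → x ∈ leaves (lookup us₂ i) → x ∈ leaves (lookup us₂ j) → i ≡ j
  index≡ = Unique-leavesL⇒index≡ us₂ uniq
  inside : ∀ {i x} → x ∈ leaves (lookup us i) → x ∈ leaves (lookup us₂ k)
  inside = ≼-leaves u≼k ∘ ∈-leavesL-lookup⁺ us _

slot-unique : ∀ {T} → IsTree T → ∀ {us us₂} → node us ≼ T → node us₂ ≼ T → ∀ {i j i₂ j₂} → i ≢ j → i₂ ≢ j₂ →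
  ∀ t {e e₂} → slotEdge (lookup us i) (lookup us j) t ≡ just e → slotEdge (lookup us₂ i₂) (lookup us₂ j₂) t ≡ just e₂ →
  lookup us₂ i₂ ≡ lookup us i × lookup us₂ j₂ ≡ lookup us j
slot-unique isT {us} {us₂} u≼T u₂≼T {i} {j} {i₂} {j₂} i≢j i₂≢j₂ (a , b , c) eq eq₂
  with a∈i , c∈j ← slotEdge-just⇒∈ (lookup us i) (lookup us j) a b c eq
  with a∈i₂ , c∈j₂ ← slotEdge-just⇒∈ (lookup us₂ i₂) (lookup us₂ j₂) a b c eq₂
  with ≼-laminar (IsTree-Unique isT here) u≼T u₂≼T (∈-leavesL-lookup⁺ us i a∈i) (∈-leavesL-lookup⁺ us₂ i₂ a∈i₂)
... | inj₁ u≼u₂ = slot-nested (IsTree-Unique isT u₂≼T) u≼u₂ i₂≢j₂ a∈i c∈j a∈i₂ c∈j₂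
... | inj₂ u₂≼u with i≡ , j≡ ← slot-nested (IsTree-Unique isT u≼T) u₂≼u i≢j a∈i₂ c∈j₂ a∈i c∈j = sym i≡ , sym j≡


-- Connected slot graphs force refinement

module Refinement (T : Tree) (isT : IsTree T) (R : List Triple) (slotsConn : SlotsConnected T R)
                  (T′ : Tree) (isT′ : IsTree T′) (displays′ : DisplaysAll T′ R) where

  ChildInsideChild : Tree → Set
  ChildInsideChild w = ∀ {us} → node us ≼ T → ∀ l → lookup us l ≡ w → ∀ l′ → l ≢ l′ →
    ∀ {ds} → node ds ≼ T′ → leaves w ⊆ leavesL ds → leaves (lookup us l′) ⊆ leavesL ds →
    Σ (Fin (length ds)) λ k → leaves w ⊆ leaves (lookup ds k)

  childInsideChild : ∀ w → ChildInsideChild w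
  childInsideChild = Tree-ind ChildInsideChild leaf-case node-case
    where
    leaf-case : ∀ y → ChildInsideChild (leaf y)
    leaf-case y _ _ _ _ _ {ds} _ y⊆d _ with k , y∈k ← ∈-leavesL⁻ ds (y⊆d (here refl)) =
      k , λ { (here refl) → y∈k }

    node-case : ∀ ws → (∀ p → ChildInsideChild (lookup ws p)) → ChildInsideChild (node ws)
    node-case ws ih {us} u≼T l l≡w l′ l≢l′ {ds} d≼T′ w⊆d s⊆d = k₀ , w⊆k₀
      where
      w≼T : node ws ≼ T
      w≼T = subst (_≼ T) l≡w (≼-trans (lookup-≼ us l) u≼T)

      conn : Connected (length ws) (slotGraph (node ws) (lookup us l′) R)
      conn = SlotsConnected-inner R slotsConn u≼T l l′ l≢l′ l≡w

      inside : ∀ p → Σ (Fin (length ds)) λ k → leaves (lookup ws p) ⊆ leaves (lookup ds k)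
      inside p with p′ , p≢p′ ← anotherIndex (IsTree-≢1 isT w≼T) p =
        ih p w≼T p refl p′ p≢p′ d≼T′ (w⊆d ∘ ∈-leavesL-lookup⁺ ws p) (w⊆d ∘ ∈-leavesL-lookup⁺ ws p′)

      f : Fin (length ws) → Fin (length ds)
      f p = proj₁ (inside p)

      f≡ : ∀ p {x k} → x ∈ leaves (lookup ws p) → x ∈ leaves (lookup ds k) → f p ≡ k
      f≡ p x∈p x∈k = Unique-leavesL⇒index≡ ds (IsTree-Unique isT′ d≼T′) (proj₂ (inside p) x∈p) x∈k

      p₀ : Fin (length ws)
      p₀ = proj₁ (∈-leavesL⁻ ws (proj₂ (NonRootWF⇒leaf (subst NonRootWF l≡w (IsTree-child isT u≼T l)))))

      k₀ : Fin (length ds)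
      k₀ = f p₀

      -- Since T′ displays R, no edge of the slot graph joins two colour classes of S.
      S : Fin (length ws) → Bool
      S p = does (f p ≟ᶠ k₀)

      edge-uncut : ∀ {t e} → t ∈ R → slotEdge (node ws) (lookup us l′) t ≡ just e → S (proj₁ e) ≡ S (proj₂ e)
      edge-uncut {a , b , c} {p , q} t∈R eq
        with c∈s , a∈p , b∈q ← slotEdge-just⁻ (node ws) (lookup us l′) a b c eq
        with _ , _ , _ , separator ← displays′ (a , b , c) t∈R
        with k , a∈k , b∈k ← separated-inside-child (IsTree-Unique isT′ here) d≼T′ separator
                               (w⊆d (∈-leavesL-lookup⁺ ws p a∈p)) (s⊆d c∈s) =
        cong (λ k → does (k ≟ᶠ k₀)) (trans (f≡ p a∈p a∈k) (sym (f≡ q b∈q b∈k)))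

      f≡k₀ : ∀ p → f p ≡ k₀
      f≡k₀ p = does≡true⇒ (f p ≟ᶠ k₀)
        (trans (conn S (All-mapMaybe⁺ _ R edge-uncut) p p₀) (dec-true (k₀ ≟ᶠ k₀) refl))

      w⊆k₀ : leaves (node ws) ⊆ leaves (lookup ds k₀)
      w⊆k₀ x∈w with p , x∈p ← ∈-leavesL⁻ ws x∈w =
        subst (λ k → _ ∈ leaves (lookup ds k)) (f≡k₀ p) (proj₂ (inside p) x∈p)

  Represented : Tree → Set
  Represented v = Σ Tree λ e → e ≼ T′ × (leaves v ≈ˢ leaves e)

  Saturated : List Tree → Tree → Set
  Saturated us d = ∀ l {x} → x ∈ leaves (lookup us l) → x ∈ leaves d → leaves (lookup us l) ⊆ leaves d

  ClusterBelow : Tree → Set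
  ClusterBelow d = d ≼ T′ → ∀ {us} → node us ≼ T → ∀ i → leaves (lookup us i) ⊆ leaves d →
    leaves d ⊆ leavesL us → Saturated us d → Represented (lookup us i)

  clusterBelow : ∀ d → ClusterBelow d
  clusterBelow = Tree-ind ClusterBelow leaf-case node-case
    where
    leaf-case : ∀ y → ClusterBelow (leaf y)
    leaf-case y d≼T′ {us} u≼T i i⊆d _ _
      with x₀ , x₀∈i ← NonRootWF⇒leaf (IsTree-child isT u≼T i)
      with here refl ← i⊆d x₀∈i =
      leaf y , d≼T′ , λ _ → i⊆d , λ { (here refl) → x₀∈i }

    node-case : ∀ ds → (∀ k → ClusterBelow (lookup ds k)) → ClusterBelow (node ds)
    node-case ds ih d≼T′ {us} u≼T i i⊆d d⊆u sat with ⊆-or-outside (leavesL ds) (leaves (lookup us i))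
    ... | inj₁ d⊆i = node ds , d≼T′ , λ _ → i⊆d , d⊆i
    -- Another child l of u lies inside d, so child i lies inside a single child k of d.
    ... | inj₂ (z , z∈d , z∉i) with l , z∈l ← ∈-leavesL⁻ us (d⊆u z∈d) =
      ih k (≼-trans (lookup-≼ ds k) d≼T′) u≼T i i⊆k (d⊆u ∘ ∈-leavesL-lookup⁺ ds k) sat-k
      where
      i≢l : i ≢ l
      i≢l refl = z∉i z∈l

      i-inside : Σ (Fin (length ds)) λ k → leaves (lookup us i) ⊆ leaves (lookup ds k)
      i-inside = childInsideChild (lookup us i) u≼T i refl l i≢l d≼T′ i⊆d (sat l z∈l z∈d)

      k : Fin (length ds)
      k = proj₁ i-inside

      i⊆k : leaves (lookup us i) ⊆ leaves (lookup ds k)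
      i⊆k = proj₂ i-inside

      sat-k : Saturated us (lookup ds k)
      sat-k l′ x∈l′ x∈k with l′ ≟ᶠ i
      ... | yes refl = i⊆k
      ... | no l′≢i
        with k′ , l′⊆k′ ← childInsideChild (lookup us l′) u≼T l′ refl i l′≢i d≼T′
                            (sat l′ x∈l′ (∈-leavesL-lookup⁺ ds k x∈k)) i⊆d
        with refl ← Unique-leavesL⇒index≡ ds (IsTree-Unique isT′ d≼T′) (l′⊆k′ x∈l′) x∈k = l′⊆k′

  Represented-descends : ∀ {t s} → t ≼ T → s ≼ t → Represented t → Represented s
  Represented-descends t≼T here rep = rep
  Represented-descends {node ts} t≼T (there c∈ s≼c) (e , e≼T′ , t≈e) =
    Represented-descends (≼-trans (child-≼ c∈) t≼T) s≼c (subst Represented (sym (lookup-index c∈)) child-rep)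
    where
    child-rep : Represented (lookup ts (index c∈))
    child-rep = clusterBelow e e≼T′ t≼T (index c∈)
      (proj₁ (t≈e _) ∘ ∈-leavesL-lookup⁺ ts (index c∈)) (proj₂ (t≈e _))
      (λ l _ _ → proj₁ (t≈e _) ∘ ∈-leavesL-lookup⁺ ts l)

  refines : leaves T ≈ˢ leaves T′ → Refines T′ T
  refines T≈T′ v v≼T = Represented-descends here v≼T (T′ , here , T≈T′)


∈-labels⁺ : ∀ {R a b c} → (a , b , c) ∈ R → a ∈ labels R × b ∈ labels R × c ∈ labels R
∈-labels⁺ {_ ∷ R} (here refl) = here refl , there (here refl) , there (there (here refl))
∈-labels⁺ {_ ∷ R} (there t∈)  with a∈ , b∈ , c∈ ← ∈-labels⁺ t∈ =
  there (there (there a∈)) , there (there (there b∈)) , there (there (there c∈))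

∈-labels⁻ : ∀ R {x} → x ∈ labels R → Σ Triple λ t → t ∈ R × x ∈ labels (t ∷ [])
∈-labels⁻ (t ∷ R) (here refl)                 = t , here refl , here refl
∈-labels⁻ (t ∷ R) (there (here refl))         = t , here refl , there (here refl)
∈-labels⁻ (t ∷ R) (there (there (here refl))) = t , here refl , there (there (here refl))
∈-labels⁻ (t ∷ R) (there (there (there x∈)))  with t′ , t′∈ , x∈t′ ← ∈-labels⁻ R x∈ = t′ , there t′∈ , x∈t′

Displays⇒labels⊆leaves : ∀ {T} t → Displays T t → labels (t ∷ []) ⊆ leaves T
Displays⇒labels⊆leaves (a , b , c) (a∈ , b∈ , c∈ , _) (here refl)                 = a∈
Displays⇒labels⊆leaves (a , b , c) (a∈ , b∈ , c∈ , _) (there (here refl))         = b∈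
Displays⇒labels⊆leaves (a , b , c) (a∈ , b∈ , c∈ , _) (there (there (here refl))) = c∈

labels-⊆ : ∀ {R Y} → (∀ {a b c} → (a , b , c) ∈ R → a ∈ Y × b ∈ Y × c ∈ Y) → labels R ⊆ Y
labels-⊆ {(a , b , c) ∷ R} hyp (here refl)                 = proj₁ (hyp (here refl))
labels-⊆ {(a , b , c) ∷ R} hyp (there (here refl))         = proj₁ (proj₂ (hyp (here refl)))
labels-⊆ {(a , b , c) ∷ R} hyp (there (there (here refl))) = proj₂ (proj₂ (hyp (here refl)))
labels-⊆ {(a , b , c) ∷ R} hyp (there (there (there x∈)))  = labels-⊆ (hyp ∘ there) x∈

labels-mono : ∀ {R R′} → R ⊆ᵗ R′ → labels R ⊆ labels R′
labels-mono R⊆R′ = labels-⊆ (∈-labels⁺ ∘ R⊆R′ _)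

labels-not-singleton : ∀ R → All ValidTriple R → ∀ {y} → y ∈ labels R → labels R ⊆ y ∷ [] → ⊥
labels-not-singleton ((a , b , c) ∷ _) ((a<b , _) ∷ _) _ ⊆y
  with here refl ← ⊆y (here refl) | here refl ← ⊆y (there (here refl)) = <-irrefl refl a<b

∈-L⁺ : ∀ R {x} → x ∈ labels R → x ∈ L R
∈-L⁺ R = ∈-deduplicate⁺ _≟_

∈-L⁻ : ∀ R {x} → x ∈ L R → x ∈ labels R
∈-L⁻ R = ∈-deduplicate⁻ _≟_ (labels R)

inner≢leaf : ∀ us {i j ws x} → lookup us i ≡ node ws → lookup us j ≡ leaf x → i ≢ j
inner≢leaf _ i≡w j≡x refl with () ← trans (sym i≡w) j≡x

InnerChild : List Tree → Set
InnerChild us = Σ (Fin (length us)) λ j → Σ (List Tree) λ ws → lookup us j ≡ node ws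

Displays⇒InnerChild : ∀ us {a b c} → a ≢ b → Displays (node us) (a , b , c) → InnerChild us
Displays⇒InnerChild us a≢b (_ , _ , c∈T , v , v≼T , a∈v , b∈v , c∉v) with ≼-node⁻ v≼T
... | inj₁ refl = ⊥-elim (c∉v c∈T)
... | inj₂ (k , v≼k) with lookup us k in eq
...   | node ws = k , ws , eq
...   | leaf y with here ← v≼k with here refl ← a∈v with here refl ← b∈v = ⊥-elim (a≢b refl)

-- Every vertex of a connected slot graph with at least two vertices lies on an edge, whose triple
-- then names the leaves below that vertex (as a or b) or below the sibling (as c).
module Coverage (T : Tree) (isT : IsTree T) (R : List Triple) (slotsConn : SlotsConnected T R) where

  incidentTriple : ∀ {us} → node us ≼ T → ∀ i j → i ≢ j → ∀ {ws} → lookup us i ≡ node ws → ∀ p q → p ≢ q →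
    Σ Triple λ t → t ∈ R × Σ (Edge (length ws)) λ e →
      slotEdge (node ws) (lookup us j) t ≡ just e × (proj₁ e ≡ p ⊎ proj₂ e ≡ p)
  incidentTriple {us} u≼T i j i≢j {ws} i≡w p q p≢q
    with e , e∈ , touches ← Connected⇒incident (SlotsConnected-inner R slotsConn u≼T i j i≢j i≡w) p q p≢q
    with t , t∈ , eq ← ∈-mapMaybe⁻ (slotEdge (node ws) (lookup us j)) R e∈ = t , t∈ , e , eq , touches

  innerChild-≢1 : ∀ {us} → node us ≼ T → ∀ i {ws} → lookup us i ≡ node ws → length ws ≢ 1
  innerChild-≢1 {us} u≼T i i≡w = IsTree-≢1 isT (subst (_≼ T) i≡w (≼-trans (lookup-≼ us i) u≼T))

  leafGrandchild-labelled : ∀ {us} → node us ≼ T → ∀ i {ws} → lookup us i ≡ node ws →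
                            ∀ p {x} → lookup ws p ≡ leaf x → x ∈ labels R
  leafGrandchild-labelled {us} u≼T i {ws} i≡w p p≡x
    with j , i≢j ← anotherIndex (IsTree-≢1 isT u≼T) i
    with q , p≢q ← anotherIndex (innerChild-≢1 u≼T i i≡w) p
    with (a , b , c) , t∈ , (r₁ , r₂) , eq , touches ← incidentTriple u≼T i j i≢j i≡w p q p≢q
    with _ , a∈ , b∈ ← slotEdge-just⁻ (node ws) (lookup us j) a b c eq | touches
  ... | inj₁ refl = subst (_∈ labels R) (leaf-∈ (subst (λ v → a ∈ leaves v) p≡x a∈)) (proj₁ (∈-labels⁺ t∈))
  ... | inj₂ refl = subst (_∈ labels R) (leaf-∈ (subst (λ v → b ∈ leaves v) p≡x b∈)) (proj₁ (proj₂ (∈-labels⁺ t∈)))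

  leafChild-labelled : ∀ {us} → node us ≼ T → ∀ i {ws} → lookup us i ≡ node ws →
                       ∀ j {x} → lookup us j ≡ leaf x → x ∈ labels R
  leafChild-labelled {us} u≼T i {ws} i≡w j j≡x
    with p , x∈p ← ∈-leavesL⁻ ws (proj₂ (NonRootWF⇒leaf (subst NonRootWF i≡w (IsTree-child isT u≼T i))))
    with q , p≢q ← anotherIndex (innerChild-≢1 u≼T i i≡w) p
    with (a , b , c) , t∈ , _ , eq , _ ← incidentTriple u≼T i j (inner≢leaf us i≡w j≡x) i≡w p q p≢q
    with c∈ , _ ← slotEdge-just⁻ (node ws) (lookup us j) a b c eq =
    subst (_∈ labels R) (leaf-∈ (subst (λ v → c ∈ leaves v) j≡x c∈)) (proj₂ (proj₂ (∈-labels⁺ t∈)))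

  GrandchildrenLabelled : Tree → Set
  GrandchildrenLabelled w = ∀ {us} → node us ≼ T → ∀ i → lookup us i ≡ w → leavesL (childList w) ⊆ labels R

  grandchildrenLabelled : ∀ w → GrandchildrenLabelled w
  grandchildrenLabelled = Tree-ind GrandchildrenLabelled (λ _ _ _ _ ()) node-case
    where
    node-case : ∀ ws → (∀ p → GrandchildrenLabelled (lookup ws p)) → GrandchildrenLabelled (node ws)
    node-case ws ih {us} u≼T i i≡w x∈ with p , x∈p ← ∈-leavesL⁻ ws x∈ | lookup ws p in p≡
    ... | leaf y with refl ← leaf-∈ x∈p = leafGrandchild-labelled u≼T i i≡w p p≡
    ... | node zs = ih p (subst (_≼ T) i≡w (≼-trans (lookup-≼ us i) u≼T)) p refl
                      (subst (λ v → _ ∈ leavesL (childList v)) (sym p≡) x∈p)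

  leaves⊆labels : ∀ {us} → T ≡ node us → InnerChild us → leaves T ⊆ labels R
  leaves⊆labels {us} refl (j , ws , j≡w) x∈ with i , x∈i ← ∈-leavesL⁻ us x∈ | lookup us i in i≡
  ... | leaf y with refl ← leaf-∈ x∈i = leafChild-labelled here j j≡w i i≡
  ... | node zs = grandchildrenLabelled (node zs) here i i≡ x∈i

module Closure (R : List Triple) (T : Tree) (idf : Identifies R T) where

  isT : IsTree T
  isT = proj₁ idf

  leafSet : HasLeafSet T R
  leafSet = proj₁ (proj₂ idf)

  displaysR : DisplaysAll T R
  displaysR = proj₁ (proj₂ (proj₂ idf))

  InCl⇒Displays : ∀ t → InCl R t → Displays T t
  InCl⇒Displays t inCl = inCl T isT leafSet displaysR

  Displays⇒InCl : ∀ t → Displays T t → InCl R t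
  Displays⇒InCl t disp T′ isT′ leafSet′ displays′ =
    Refines-Displays (proj₂ (proj₂ (proj₂ idf)) T′ isT′ leafSet′ displays′)
      (λ {x} → proj₂ (leafSet′ x) ∘ proj₁ (leafSet x)) t disp

  HasLeafSet-⊆ : ∀ {R″} → R″ ⊆ᵗ R → leaves T ⊆ labels R″ → HasLeafSet T R″
  HasLeafSet-⊆ {R″} R″⊆R T⊆R″ x = ∈-L⁺ R″ ∘ T⊆R″ , proj₂ (leafSet x) ∘ ∈-L⁺ R ∘ labels-mono R″⊆R ∘ ∈-L⁻ R″

  SlotsConnected⇒SameCl : ∀ {R″} → R″ ⊆ᵗ R → SlotsConnected T R″ → leaves T ⊆ labels R″ → SameCl R″ R
  SlotsConnected⇒SameCl {R″} R″⊆R slotsConn T⊆R″ t _ = to , from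
    where
    leafSet″ : HasLeafSet T R″
    leafSet″ = HasLeafSet-⊆ R″⊆R T⊆R″

    to : InCl R″ t → InCl R t
    to inCl = Displays⇒InCl t (inCl T isT leafSet″ (λ t′ → displaysR t′ ∘ R″⊆R t′))

    from : InCl R t → InCl R″ t
    from inCl T′ isT′ leafSet′ displays′ =
      Refines-Displays (Refinement.refines T isT R″ slotsConn T′ isT′ displays′ T≈T′) (λ {x} → proj₁ (T≈T′ x))
        t (InCl⇒Displays t inCl)
      where
      T≈T′ : leaves T ≈ˢ leaves T′
      T≈T′ x = proj₂ (leafSet′ x) ∘ proj₁ (leafSet″ x) , proj₂ (leafSet″ x) ∘ proj₁ (leafSet′ x)


partition : (ts : List Tree) → (Fin (length ts) → Bool) → List Tree × List Tree
partition []       S = [] , []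
partition (t ∷ ts) S with partition ts (S ∘ suc) | S zero
... | trues , falses | true  = t ∷ trues , falses
... | trues , falses | false = trues , t ∷ falses

partition-↭ : ∀ ts S → ts ↭ proj₁ (partition ts S) ++ proj₂ (partition ts S)
partition-↭ []       S = ↭-refl
partition-↭ (t ∷ ts) S with partition ts (S ∘ suc) | partition-↭ ts (S ∘ suc) | S zero
... | trues , falses | p | true  = prep t p
... | trues , falses | p | false = ↭-trans (prep t p) (↭-sym (shift t trues falses))

∈-partition-true : ∀ ts S m → S m ≡ true → lookup ts m ∈ proj₁ (partition ts S)
∈-partition-true (t ∷ ts) S m Sm with partition ts (S ∘ suc) | ∈-partition-true ts (S ∘ suc) | S zero in S0
∈-partition-true (t ∷ ts) S zero    Sm | _ | _  | true  = here refl
∈-partition-true (t ∷ ts) S (suc m) Sm | _ | ih | true  = there (ih m Sm)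
∈-partition-true (t ∷ ts) S zero    Sm | _ | _  | false with () ← trans (sym Sm) S0
∈-partition-true (t ∷ ts) S (suc m) Sm | _ | ih | false = ih m Sm

∈-partition-false : ∀ ts S m → S m ≡ false → lookup ts m ∈ proj₂ (partition ts S)
∈-partition-false (t ∷ ts) S m Sm with partition ts (S ∘ suc) | ∈-partition-false ts (S ∘ suc) | S zero in S0
∈-partition-false (t ∷ ts) S zero    Sm | _ | _  | false = here refl
∈-partition-false (t ∷ ts) S (suc m) Sm | _ | ih | false = there (ih m Sm)
∈-partition-false (t ∷ ts) S zero    Sm | _ | _  | true  with () ← trans (sym Sm) S0
∈-partition-false (t ∷ ts) S (suc m) Sm | _ | ih | true  = ih m Sm

leavesL-∷= : ∀ {t : Tree} {ts x} (t∈ : t ∈ ts) → leaves x ↭ leaves t → leavesL (t∈ ∷= x) ↭ leavesL ts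
leavesL-∷= {ts = _ ∷ ts} (here refl) x↭t = ++⁺ʳ (leavesL ts) x↭t
leavesL-∷= {ts = t ∷ _}  (there t∈)  x↭t = ++⁺ˡ (leaves t) (leavesL-∷= t∈ x↭t)

All-∷= : ∀ {P : Tree → Set} {t : Tree} {ts x} (t∈ : t ∈ ts) → All P ts → P x → All P (t∈ ∷= x)
All-∷= (here _)   (_ ∷ pts)  px = px ∷ pts
All-∷= (there t∈) (pt ∷ pts) px = pt ∷ All-∷= t∈ pts px

replace : ∀ {u T} → u ≼ T → Tree → Tree
replace here          x = x
replace (there c∈ u≼) x = node (c∈ ∷= replace u≼ x)

leaves-replace : ∀ {u T x} (π : u ≼ T) → leaves x ↭ leaves u → leaves (replace π x) ↭ leaves T
leaves-replace here          x↭u = x↭u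
leaves-replace (there c∈ u≼) x↭u = leavesL-∷= c∈ (leaves-replace u≼ x↭u)

≼-replace : ∀ {u T x v} (π : u ≼ T) → v ≼ x → v ≼ replace π x
≼-replace here          v≼x = v≼x
≼-replace (there c∈ u≼) v≼x = there (∈-∷=-updated c∈) (≼-replace u≼ v≼x)

≼-replace-outside : ∀ {u T x v} (π : u ≼ T) → leaves x ↭ leaves u → v ≼ T →
                    v ≼ u ⊎ Σ Tree λ v′ → v′ ≼ replace π x × leaves v′ ↭ leaves v
≼-replace-outside here          _   v≼T = inj₁ v≼T
≼-replace-outside (there c∈ u≼) x↭u here = inj₂ (_ , here , leavesL-∷= c∈ (leaves-replace u≼ x↭u))
≼-replace-outside (there c∈ u≼) x↭u (there c′∈ v≼) with ∈-∷=-untouched c∈ c′∈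
... | inj₂ c′∈′ = inj₂ (_ , there c′∈′ v≼ , ↭-refl)
... | inj₁ refl with ≼-replace-outside u≼ x↭u v≼
...   | inj₁ v≼u               = inj₁ v≼u
...   | inj₂ (v′ , v′≼ , v′↭v) = inj₂ (v′ , there (∈-∷=-updated c∈) v′≼ , v′↭v)

NonRootWF-replace : ∀ {u T x} → NonRootWF T → (π : u ≼ T) → NonRootWF x → NonRootWF (replace π x)
NonRootWF-replace _                 here          wfx = wfx
NonRootWF-replace (nodeWF ts ≥2 wfs) (there c∈ u≼) wfx =
  nodeWF _ (subst (2 ≤_) (sym (length-∷= ts (index c∈) _)) ≥2)
    (All-∷= c∈ wfs (NonRootWF-replace (All.lookup wfs c∈) u≼ wfx))

IsTree-replace : ∀ {u T xs} → IsTree T → (π : u ≼ T) → 2 ≤ length xs → All NonRootWF xs →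
                 leavesL xs ↭ leaves u → IsTree (replace π (node xs))
IsTree-replace {xs = xs} (_ , refl , _ , _ , uniq) here ≥2 wfs xs↭u =
  xs , refl , >⇒≢ ≥2 , wfs , Unique-resp-↭ (↭-sym xs↭u) uniq
IsTree-replace (ts , refl , ≢1 , wfs , uniq) (there c∈ u≼) ≥2 wfxs xs↭u =
  c∈ ∷= replace u≼ _ , refl , ≢1 ∘ trans (sym (length-∷= ts (index c∈) _)) ,
  All-∷= c∈ wfs (NonRootWF-replace (All.lookup wfs c∈) u≼ (nodeWF _ ≥2 wfxs)) ,
  Unique-resp-↭ (↭-sym (leaves-replace (there c∈ u≼) xs↭u)) uniq


-- A tree separating a disconnected slot graph

ordered : ℕ → ℕ → ℕ → Triple
ordered x y z with x <? y
... | yes _ = x , y , z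
... | no _  = y , x , z

ValidTriple-ordered : ∀ {x y z} → x ≢ y → x ≢ z → y ≢ z → ValidTriple (ordered x y z)
ValidTriple-ordered {x} {y} x≢y x≢z y≢z with x <? y
... | yes x<y = x<y , x≢z , y≢z
... | no x≮y  = ≤∧≢⇒< (≮⇒≥ x≮y) (x≢y ∘ sym) , y≢z , x≢z

Displays-ordered : ∀ {T x y z} → Displays T (x , y , z) → Displays T (ordered x y z)
Displays-ordered {x = x} {y} disp with x <? y
... | yes _ = disp
... | no _  with x∈ , y∈ , z∈ , v , v≼ , x∈v , y∈v , z∉v ← disp = y∈ , x∈ , z∈ , v , v≼ , y∈v , x∈v , z∉v

Displays-ordered⁻ : ∀ {T x y z} → Displays T (ordered x y z) → Displays T (x , y , z)
Displays-ordered⁻ {x = x} {y} disp with x <? y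
... | yes _ = disp
... | no _  with y∈ , x∈ , z∈ , v , v≼ , y∈v , x∈v , z∉v ← disp = x∈ , y∈ , z∈ , v , v≼ , x∈v , y∈v , z∉v

-- group and insertCluster avoid creating an inner vertex with a single child.
group : List Tree → Tree
group (t ∷ []) = t
group ts       = node ts

leaves-group : ∀ ts → leaves (group ts) ↭ leavesL ts
leaves-group []           = ↭-refl
leaves-group (t ∷ [])     = ↭-reflexive (sym (++-identityʳ (leaves t)))
leaves-group (_ ∷ _ ∷ _)  = ↭-refl

≼-group : ∀ {t ts} → t ∈ ts → t ≼ group ts
≼-group {ts = _ ∷ []}    (here refl) = here
≼-group {ts = _ ∷ _ ∷ _} t∈          = child-≼ t∈

NonRootWF-group : ∀ {t ts} → t ∈ ts → All NonRootWF ts → NonRootWF (group ts)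
NonRootWF-group {ts = _ ∷ []}    _ (wf ∷ []) = wf
NonRootWF-group {ts = _ ∷ _ ∷ _} _ wfs       = nodeWF _ (s≤s (s≤s z≤n)) wfs

insertCluster : List Tree → List Tree → List Tree
insertCluster cs []       = cs
insertCluster cs (r ∷ rs) = node cs ∷ r ∷ rs

leavesL-insertCluster : ∀ cs rs → leavesL (insertCluster cs rs) ↭ leavesL cs ++ leavesL rs
leavesL-insertCluster cs []      = ↭-reflexive (sym (++-identityʳ (leavesL cs)))
leavesL-insertCluster cs (_ ∷ _) = ↭-refl

-- S colours the children of w = us[i] without cutting an edge of the slot graph of (w, s = us[j]),
-- and is not constant.  T′ replaces u by a vertex with the other children of u and a new cluster N
-- whose children are s and the groups gT, gF of the two colour classes.  T′ still displays R: a
-- triple separated by w with a and b of different colours has c ∉ s (otherwise its edge would be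
-- cut), so N separates it.  Yet T′ does not display xy|z for x, y below differently coloured
-- children of w and z below s.
module SeparatingTree (T : Tree) (isT : IsTree T) (R : List Triple) (displaysR : DisplaysAll T R)
  {us : List Tree} (u≼T : node us ≼ T) (i j : Fin (length us)) (i≢j : i ≢ j)
  {ws : List Tree} (i≡w : lookup us i ≡ node ws)
  (S : Fin (length ws) → Bool) (uncut : Uncut S (slotGraph (node ws) (lookup us j) R))
  {p q : Fin (length ws)} (Sp : S p ≡ true) (Sq : S q ≡ false) where

  s : Tree
  s = lookup us j

  w≼T : node ws ≼ T
  w≼T = subst (_≼ T) i≡w (≼-trans (lookup-≼ us i) u≼T)

  w∩s : ∀ {x} → x ∈ leavesL ws → x ∉ leaves s
  w∩s x∈w x∈s = i≢j (Unique-leavesL⇒index≡ us (IsTree-Unique isT u≼T) (subst (λ v → _ ∈ leaves v) (sym i≡w) x∈w) x∈s)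

  trues falses : List Tree
  trues  = proj₁ (partition ws S)
  falses = proj₂ (partition ws S)

  gT gF N : Tree
  gT = group trues
  gF = group falses
  N  = node (gT ∷ gF ∷ s ∷ [])

  rest-decomposition : ∃ λ rest → us ↭ node ws ∷ s ∷ rest
  rest-decomposition with ys , us↭ ← ∈⇒↭∷ (∈-lookup {xs = us} i) | ∈-resp-↭ us↭ (∈-lookup {xs = us} j)
  ... | here s≡w   = ⊥-elim (IsTree-lookup-injective isT u≼T i j i≢j (sym s≡w))
  ... | there s∈ys with rest , ys↭ ← ∈⇒↭∷ s∈ys =
    rest , ↭-trans us↭ (↭-trans (prep _ ys↭) (↭-reflexive (cong (λ v → v ∷ s ∷ rest) i≡w)))

  rest : List Tree
  rest = proj₁ rest-decomposition

  U : Tree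
  U = node (insertCluster (gT ∷ gF ∷ s ∷ []) rest)

  T′ : Tree
  T′ = replace u≼T U

  ws↭ : leavesL ws ↭ leavesL trues ++ leavesL falses
  ws↭ = ↭-trans (leavesL-↭ (partition-↭ ws S)) (↭-reflexive (leavesL-++ trues falses))

  leaves-N : leaves N ↭ leavesL ws ++ leaves s
  leaves-N = ↭-trans (↭-reflexive (cong (λ l → leaves gT ++ leaves gF ++ l) (++-identityʳ (leaves s))))
    (↭-trans (↭-reflexive (sym (++-assoc (leaves gT) (leaves gF) (leaves s))))
      (++⁺ʳ (leaves s) (↭-trans (++⁺ (leaves-group trues) (leaves-group falses)) (↭-sym ws↭))))

  leaves-U : leaves U ↭ leavesL us
  leaves-U = ↭-trans (leavesL-insertCluster (gT ∷ gF ∷ s ∷ []) rest)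
    (↭-trans (++⁺ʳ (leavesL rest) leaves-N)
      (↭-trans (↭-reflexive (++-assoc (leavesL ws) (leaves s) (leavesL rest)))
        (↭-sym (leavesL-↭ (proj₂ rest-decomposition)))))

  leaves-T′ : leaves T′ ↭ leaves T
  leaves-T′ = leaves-replace u≼T leaves-U

  N≼U : N ≼ U
  N≼U with rest
  ... | []    = here
  ... | _ ∷ _ = child-≼ (here refl)

  rest≼U : ∀ {r} → r ∈ rest → r ≼ U
  rest≼U r∈ with rest
  ... | _ ∷ _ = child-≼ (there r∈)

  gT≼U : gT ≼ U
  gT≼U = ≼-trans (child-≼ (here refl)) N≼U

  gF≼U : gF ≼ U
  gF≼U = ≼-trans (child-≼ (there (here refl))) N≼U

  s≼N : s ≼ N
  s≼N = child-≼ (there (there (here refl)))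

  IsTree-T′ : IsTree T′
  IsTree-T′ = IsTree-replace isT u≼T (≥2 rest) (wf-cluster rest wf-rest) leaves-U
    where
    wf-trues : All NonRootWF trues
    wf-trues = ++⁻ˡ trues (All-resp-↭ (partition-↭ ws S) (IsTree-children isT w≼T))
    wf-falses : All NonRootWF falses
    wf-falses = ++⁻ʳ trues (All-resp-↭ (partition-↭ ws S) (IsTree-children isT w≼T))
    wf-rest : All NonRootWF rest
    wf-rest with _ ∷ _ ∷ wfs ← All-resp-↭ (proj₂ rest-decomposition) (IsTree-children isT u≼T) = wfs
    wf-N : All NonRootWF (gT ∷ gF ∷ s ∷ [])
    wf-N = NonRootWF-group (∈-partition-true ws S p Sp) wf-trues
         ∷ NonRootWF-group (∈-partition-false ws S q Sq) wf-falses
         ∷ IsTree-child isT u≼T j ∷ []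
    wf-cluster : ∀ rs → All NonRootWF rs → All NonRootWF (insertCluster (gT ∷ gF ∷ s ∷ []) rs)
    wf-cluster []      _   = wf-N
    wf-cluster (_ ∷ _) wfs = nodeWF _ (s≤s (s≤s z≤n)) wf-N ∷ wfs
    ≥2 : ∀ rs → 2 ≤ length (insertCluster (gT ∷ gF ∷ s ∷ []) rs)
    ≥2 []      = s≤s (s≤s z≤n)
    ≥2 (_ ∷ _) = s≤s (s≤s z≤n)

  SeparatedInU : Triple → Set
  SeparatedInU t = Σ Tree λ v → v ≼ U × Separates v t

  ∈-gT : ∀ m {x} → S m ≡ true → x ∈ leaves (lookup ws m) → x ∈ leaves gT
  ∈-gT m Sm x∈ = ∈-resp-↭ (↭-sym (leaves-group trues)) (∈-leavesL⁺ (∈-partition-true ws S m Sm) x∈)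

  ∈-gF : ∀ m {x} → S m ≡ false → x ∈ leaves (lookup ws m) → x ∈ leaves gF
  ∈-gF m Sm x∈ = ∈-resp-↭ (↭-sym (leaves-group falses)) (∈-leavesL⁺ (∈-partition-false ws S m Sm) x∈)

  gT⊆w : ∀ {x} → x ∈ leaves gT → x ∈ leavesL ws
  gT⊆w = ∈-resp-↭ (↭-sym ws↭) ∘ ∈-++⁺ˡ ∘ ∈-resp-↭ (leaves-group trues)

  gF⊆w : ∀ {x} → x ∈ leaves gF → x ∈ leavesL ws
  gF⊆w = ∈-resp-↭ (↭-sym ws↭) ∘ ∈-++⁺ʳ (leavesL trues) ∘ ∈-resp-↭ (leaves-group falses)

  separatedAt-w : ∀ {a b c} → (a , b , c) ∈ R → Separates (node ws) (a , b , c) → SeparatedInU (a , b , c)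
  separatedAt-w {a} {b} {c} t∈ (a∈w , b∈w , c∉w)
    with p₁ , a∈p₁ ← ∈-leavesL⁻ ws a∈w
    with q₁ , b∈q₁ ← ∈-leavesL⁻ ws b∈w
    with S p₁ Data.Bool.≟ S q₁ | S p₁ in Sp₁
  ... | yes same | true  = gT , gT≼U , ∈-gT p₁ Sp₁ a∈p₁ , ∈-gT q₁ (trans (sym same) Sp₁) b∈q₁ , c∉w ∘ gT⊆w
  ... | yes same | false = gF , gF≼U , ∈-gF p₁ Sp₁ a∈p₁ , ∈-gF q₁ (trans (sym same) Sp₁) b∈q₁ , c∉w ∘ gF⊆w
  ... | no differ | _ with c ∈? leaves s
  ...   | yes c∈s = ⊥-elim (differ (All.lookup uncut
                      (∈-mapMaybe⁺ (slotEdge (node ws) s) t∈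
                        (slotEdge-just⁺ (node ws) s a b c (IsTree-Unique isT w≼T) c∈s a∈p₁ b∈q₁))))
  ...   | no c∉s  = N , N≼U , inN a∈w , inN b∈w , [ c∉w , c∉s ]′ ∘ ∈-++⁻ (leavesL ws) ∘ ∈-resp-↭ leaves-N
    where
    inN : ∀ {x} → x ∈ leavesL ws → x ∈ leaves N
    inN = ∈-resp-↭ (↭-sym leaves-N) ∘ ∈-++⁺ˡ

  separatedBelow-w : ∀ {v a b c} → (a , b , c) ∈ R → v ≼ node ws → Separates v (a , b , c) → SeparatedInU (a , b , c)
  separatedBelow-w t∈ v≼w sep with ≼-node⁻ v≼w
  ... | inj₁ refl      = separatedAt-w t∈ sep
  ... | inj₂ (m , v≼m) with S m in Sm
  ...   | true  = _ , ≼-trans v≼m (≼-trans (≼-group (∈-partition-true ws S m Sm)) gT≼U) , sep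
  ...   | false = _ , ≼-trans v≼m (≼-trans (≼-group (∈-partition-false ws S m Sm)) gF≼U) , sep

  separatedBelow-child : ∀ {v a b c} k → (a , b , c) ∈ R → v ≼ lookup us k → Separates v (a , b , c) →
                         SeparatedInU (a , b , c)
  separatedBelow-child k t∈ v≼k sep with k ≟ᶠ i | k ≟ᶠ j
  ... | yes refl | _        = separatedBelow-w t∈ (subst (_ ≼_) i≡w v≼k) sep
  ... | no _     | yes refl = _ , ≼-trans v≼k (≼-trans s≼N N≼U) , sep
  ... | no k≢i   | no k≢j   with ∈-resp-↭ (proj₂ rest-decomposition) (∈-lookup {xs = us} k)
  ...   | here k≡w             = ⊥-elim (IsTree-lookup-injective isT u≼T k i k≢i (trans k≡w (sym i≡w)))
  ...   | there (here k≡s)     = ⊥-elim (IsTree-lookup-injective isT u≼T k j k≢j k≡s)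
  ...   | there (there k∈rest) = _ , ≼-trans v≼k (rest≼U k∈rest) , sep

  separatedBelow-u : ∀ {v a b c} → (a , b , c) ∈ R → v ≼ node us → Separates v (a , b , c) → SeparatedInU (a , b , c)
  separatedBelow-u t∈ v≼u (a∈v , b∈v , c∉v) with ≼-node⁻ v≼u
  ... | inj₁ refl      = U , here , inU a∈v , inU b∈v , c∉v ∘ ∈-resp-↭ leaves-U
    where
    inU : ∀ {x} → x ∈ leavesL us → x ∈ leaves U
    inU = ∈-resp-↭ (↭-sym leaves-U)
  ... | inj₂ (k , v≼k) = separatedBelow-child k t∈ v≼k (a∈v , b∈v , c∉v)

  displaysR′ : DisplaysAll T′ R
  displaysR′ (a , b , c) t∈ with a∈ , b∈ , c∈ , v , v≼T , a∈v , b∈v , c∉v ← displaysR (a , b , c) t∈ =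
    inT′ a∈ , inT′ b∈ , inT′ c∈ , separator
    where
    inT′ : ∀ {x} → x ∈ leaves T → x ∈ leaves T′
    inT′ = ∈-resp-↭ (↭-sym leaves-T′)
    separator : Σ Tree λ v′ → v′ ≼ T′ × Separates v′ (a , b , c)
    separator with ≼-replace-outside u≼T leaves-U v≼T
    ... | inj₂ (v′ , v′≼T′ , v′↭v) =
      v′ , v′≼T′ , ∈-resp-↭ (↭-sym v′↭v) a∈v , ∈-resp-↭ (↭-sym v′↭v) b∈v , c∉v ∘ ∈-resp-↭ v′↭v
    ... | inj₁ v≼u with v′ , v′≼U , sep′ ← separatedBelow-u t∈ v≼u (a∈v , b∈v , c∉v) =
      v′ , ≼-replace u≼T v′≼U , sep′

  x y z : ℕ
  x = proj₁ (NonRootWF⇒leaf (All.lookup (IsTree-children isT w≼T) (∈-lookup {xs = ws} p)))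
  y = proj₁ (NonRootWF⇒leaf (All.lookup (IsTree-children isT w≼T) (∈-lookup {xs = ws} q)))
  z = proj₁ (NonRootWF⇒leaf (IsTree-child isT u≼T j))

  x∈p : x ∈ leaves (lookup ws p)
  x∈p = proj₂ (NonRootWF⇒leaf (All.lookup (IsTree-children isT w≼T) (∈-lookup {xs = ws} p)))

  y∈q : y ∈ leaves (lookup ws q)
  y∈q = proj₂ (NonRootWF⇒leaf (All.lookup (IsTree-children isT w≼T) (∈-lookup {xs = ws} q)))

  z∈s : z ∈ leaves s
  z∈s = proj₂ (NonRootWF⇒leaf (IsTree-child isT u≼T j))

  x∈w : x ∈ leavesL ws
  x∈w = ∈-leavesL-lookup⁺ ws p x∈p

  y∈w : y ∈ leavesL ws
  y∈w = ∈-leavesL-lookup⁺ ws q y∈q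

  x≢y : x ≢ y
  x≢y x≡y with refl ← Unique-leavesL⇒index≡ ws (IsTree-Unique isT w≼T) x∈p (subst (_∈ leaves (lookup ws q)) (sym x≡y) y∈q)
    with () ← trans (sym Sp) Sq

  t₀ : Triple
  t₀ = ordered x y z

  ValidTriple-t₀ : ValidTriple t₀
  ValidTriple-t₀ = ValidTriple-ordered x≢y (λ x≡z → w∩s x∈w (subst (_∈ leaves s) (sym x≡z) z∈s))
                                           (λ y≡z → w∩s y∈w (subst (_∈ leaves s) (sym y≡z) z∈s))

  T-displays-t₀ : Displays T t₀
  T-displays-t₀ = Displays-ordered (inT x∈w , inT y∈w , ≼-leaves (≼-trans (lookup-≼ us j) u≼T) z∈s ,
                                    node ws , w≼T , x∈w , y∈w , λ z∈w → w∩s z∈w z∈s)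
    where
    inT : ∀ {x} → x ∈ leavesL ws → x ∈ leaves T
    inT = ≼-leaves w≼T

  uniqN : Unique (leaves N)
  uniqN = IsTree-Unique IsTree-T′ (≼-replace u≼T N≼U)

  x∈gT : x ∈ leaves gT
  x∈gT = ∈-gT p Sp x∈p

  T′-separates-nothing : ∀ {v} → v ≼ T′ → x ∈ leaves v → y ∈ leaves v → z ∈ leaves v
  T′-separates-nothing {v} v≼T′ x∈v y∈v
    with ≼-laminar (IsTree-Unique IsTree-T′ here) v≼T′ (≼-replace u≼T N≼U) x∈v (∈-++⁺ˡ x∈gT)
  ... | inj₂ N≼v = ≼-leaves N≼v (≼-leaves s≼N z∈s)
  ... | inj₁ v≼N with ≼-node⁻ v≼N
  ...   | inj₁ refl                 = ≼-leaves s≼N z∈s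
  ...   | inj₂ (zero , v≼gT)        =
    ⊥-elim (Unique-++-disjoint (leaves gT) uniqN (≼-leaves v≼gT y∈v) (∈-++⁺ˡ (∈-gF q Sq y∈q)))
  ...   | inj₂ (suc zero , v≼gF)    = ⊥-elim (Unique-++-disjoint (leaves gT) uniqN x∈gT (∈-++⁺ˡ (≼-leaves v≼gF x∈v)))
  ...   | inj₂ (suc (suc zero) , v≼s) =
    ⊥-elim (Unique-++-disjoint (leaves gT) uniqN x∈gT (∈-++⁺ʳ (leaves gF) (∈-++⁺ˡ (≼-leaves v≼s x∈v))))

  T′-not-displays-t₀ : ¬ Displays T′ t₀
  T′-not-displays-t₀ disp with _ , _ , _ , v , v≼T′ , x∈v , y∈v , z∉v ← Displays-ordered⁻ disp =
    z∉v (T′-separates-nothing v≼T′ x∈v y∈v)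


-- Restricting a tree to a set of leaves

module Restriction (X : List ℕ) where

  keep : List ℕ → List ℕ
  keep = filter (_∈? X)

  collapse : List Tree → Maybe Tree
  collapse []            = nothing
  collapse (t ∷ [])      = just t
  collapse (t ∷ t′ ∷ ts) = just (node (t ∷ t′ ∷ ts))

  restrict : Tree → Maybe Tree
  restrictL : List Tree → List Tree
  restrict (leaf x)  = if does (x ∈? X) then just (leaf x) else nothing
  restrict (node ts) = collapse (restrictL ts)
  restrictL []       = []
  restrictL (t ∷ ts) = maybe′ _∷_ id (restrict t) (restrictL ts)

  leavesM : Maybe Tree → List ℕ
  leavesM = maybe′ leaves []

  leaves-collapse : ∀ ts → leavesM (collapse ts) ≡ leavesL ts
  leaves-collapse []            = refl
  leaves-collapse (t ∷ [])      = sym (++-identityʳ (leaves t))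
  leaves-collapse (t ∷ t′ ∷ ts) = refl

  leaves-restrict : ∀ t → leavesM (restrict t) ≡ keep (leaves t)
  leaves-restrictL : ∀ ts → leavesL (restrictL ts) ≡ keep (leavesL ts)
  leaves-restrict (leaf x) with x ∈? X
  ... | yes _ = refl
  ... | no _  = refl
  leaves-restrict (node ts) = trans (leaves-collapse (restrictL ts)) (leaves-restrictL ts)
  leaves-restrictL []       = refl
  leaves-restrictL (t ∷ ts) = trans (cons (restrict t)) (trans (cong₂ _++_ (leaves-restrict t) (leaves-restrictL ts))
                                                          (sym (filter-++ (_∈? X) (leaves t) (leavesL ts))))
    where
    cons : ∀ m → leavesL (maybe′ _∷_ id m (restrictL ts)) ≡ leavesM m ++ leavesL (restrictL ts)
    cons nothing  = refl
    cons (just _) = refl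

  leaves-restrict-just : ∀ t {t′} → restrict t ≡ just t′ → leaves t′ ≡ keep (leaves t)
  leaves-restrict-just t eq = trans (cong leavesM (sym eq)) (leaves-restrict t)

  restrict-just : ∀ t {a} → a ∈ keep (leaves t) → Σ Tree λ t′ → restrict t ≡ just t′
  restrict-just t {a} a∈ with restrict t | leaves-restrict t
  ... | just t′ | _  = t′ , refl
  ... | nothing | eq with () ← subst (a ∈_) (sym eq) a∈

  ∈-restrictL : ∀ {t t′ ts} → t ∈ ts → restrict t ≡ just t′ → t′ ∈ restrictL ts
  ∈-restrictL {ts = t ∷ ts} (here refl) eq rewrite eq = here refl
  ∈-restrictL {ts = t ∷ ts} (there t∈) eq with restrict t
  ... | nothing = ∈-restrictL t∈ eq
  ... | just _  = there (∈-restrictL t∈ eq)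

  collapse-≼ : ∀ {t ts s} → t ∈ ts → collapse ts ≡ just s → t ≼ s
  collapse-≼ {ts = _ ∷ []}    (here refl) refl = here
  collapse-≼ {ts = _ ∷ _ ∷ _} t∈          refl = child-≼ t∈

  ∈-keep⁻ : ∀ xs {x} → x ∈ keep xs → x ∈ xs × x ∈ X
  ∈-keep⁻ xs = ∈-filter⁻ (_∈? X) {xs = xs}

  ∈-keep⁺ : ∀ {xs x} → x ∈ xs → x ∈ X → x ∈ keep xs
  ∈-keep⁺ = ∈-filter⁺ (_∈? X)

  keep-≼ : ∀ {v t} → v ≼ t → keep (leaves v) ⊆ keep (leaves t)
  keep-≼ {v} v≼t a∈ = let a∈v , a∈X = ∈-keep⁻ (leaves v) a∈ in ∈-keep⁺ (≼-leaves v≼t a∈v) a∈X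

  restrict-≼ : ∀ {v t t′ v′ a} → v ≼ t → restrict t ≡ just t′ → restrict v ≡ just v′ → a ∈ leaves v′ → v′ ≼ t′
  restrict-≼ here eq eq′ _ with refl ← trans (sym eq) eq′ = here
  restrict-≼ {v} {a = a} (there {t = c} c∈ v≼c) eq eq′ a∈v′
    with c′ , c≡ ← restrict-just c (keep-≼ v≼c (subst (a ∈_) (leaves-restrict-just v eq′) a∈v′)) =
    ≼-trans (restrict-≼ v≼c c≡ eq′ a∈v′) (collapse-≼ (∈-restrictL c∈ c≡) eq)

  NonRootWF-collapse : ∀ ts {s} → All NonRootWF ts → collapse ts ≡ just s → NonRootWF s
  NonRootWF-collapse (t ∷ [])      (wf ∷ []) refl = wf
  NonRootWF-collapse (t ∷ t′ ∷ ts) wfs       refl = nodeWF _ (s≤s (s≤s z≤n)) wfs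

  NonRootWF-restrict : ∀ {t s} → NonRootWF t → restrict t ≡ just s → NonRootWF s
  NonRootWF-restrictL : ∀ {ts} → All NonRootWF ts → All NonRootWF (restrictL ts)
  NonRootWF-restrict (leafWF x) eq with x ∈? X | eq
  ... | yes _ | refl = leafWF x
  NonRootWF-restrict (nodeWF ts _ wfs) eq = NonRootWF-collapse (restrictL ts) (NonRootWF-restrictL wfs) eq
  NonRootWF-restrictL [] = []
  NonRootWF-restrictL {t ∷ _} (wf ∷ wfs) with restrict t in eq
  ... | nothing = NonRootWF-restrictL wfs
  ... | just _  = NonRootWF-restrict wf eq ∷ NonRootWF-restrictL wfs

  Displays-restrict : ∀ {T T₀ a b c} → restrict T ≡ just T₀ → a ∈ X → b ∈ X → c ∈ X →
                      Displays T (a , b , c) → Displays T₀ (a , b , c)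
  Displays-restrict {T} {T₀} {a} {b} {c} eq a∈X b∈X c∈X (a∈T , b∈T , c∈T , v , v≼T , a∈v , b∈v , c∉v)
    with v′ , v≡ ← restrict-just v (∈-keep⁺ a∈v a∈X) =
    kept-in T eq a∈T a∈X , kept-in T eq b∈T b∈X , kept-in T eq c∈T c∈X ,
    v′ , restrict-≼ v≼T eq v≡ (kept-in v v≡ a∈v a∈X) , kept-in v v≡ a∈v a∈X , kept-in v v≡ b∈v b∈X ,
    c∉v ∘ proj₁ ∘ ∈-keep⁻ (leaves v) ∘ subst (c ∈_) (leaves-restrict-just v v≡)
    where
    kept-in : ∀ t {t′ x} → restrict t ≡ just t′ → x ∈ leaves t → x ∈ X → x ∈ leaves t′
    kept-in t eq x∈t x∈X = subst (_ ∈_) (sym (leaves-restrict-just t eq)) (∈-keep⁺ x∈t x∈X)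

restriction : ∀ {T} → IsTree T → ∀ R → All ValidTriple R → DisplaysAll T R →
              Σ Tree λ T₀ → IsTree T₀ × HasLeafSet T₀ R × DisplaysAll T₀ R
restriction {T} isT R valid displays = restrictT (IsTree⇒empty⊎NonRootWF isT) (restrict T) refl
  where
  open Restriction (labels R)

  kept : labels R ⊆ keep (leaves T)
  kept x∈ = ∈-keep⁺ (labels-⊆ (λ t∈ → let a∈ , b∈ , c∈ , _ = displays _ t∈ in a∈ , b∈ , c∈) x∈) x∈

  restrictT : T ≡ node [] ⊎ NonRootWF T → ∀ m → restrict T ≡ m →
              Σ Tree λ T₀ → IsTree T₀ × HasLeafSet T₀ R × DisplaysAll T₀ R
  restrictT _ nothing eq =
    node [] , ([] , refl , (λ ()) , [] , []) , (λ x → (λ ()) , ⊥-elim ∘ unkept ∘ ∈-L⁻ R) ,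
    λ { (a , b , c) t∈ → ⊥-elim (unkept (proj₁ (∈-labels⁺ t∈))) }
    where
    unkept : ∀ {x} → x ∉ labels R
    unkept x∈ with () ← subst (_ ∈_) (trans (sym (leaves-restrict T)) (cong leavesM eq)) (kept x∈)
  restrictT (inj₁ refl) (just _) ()
  restrictT (inj₂ _) (just (leaf y)) eq =
    ⊥-elim (labels-not-singleton R valid (proj₂ (∈-keep⁻ (leaves T) (subst (y ∈_) T≡ (here refl))))
                                         (subst (_ ∈_) (sym T≡) ∘ kept))
    where
    T≡ : y ∷ [] ≡ keep (leaves T)
    T≡ = leaves-restrict-just T eq
  restrictT (inj₂ wf) (just (node ts)) eq with nodeWF _ ≥2 wfs ← NonRootWF-restrict wf eq =
    node ts ,
    (ts , refl , >⇒≢ ≥2 , wfs , subst Unique (sym T₀≡) (Unique.filter⁺ (_∈? labels R) (IsTree-Unique isT here))) ,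
    (λ x → ∈-L⁺ R ∘ proj₂ ∘ ∈-keep⁻ (leaves T) ∘ subst (x ∈_) T₀≡ , subst (x ∈_) (sym T₀≡) ∘ kept ∘ ∈-L⁻ R) ,
    λ { (a , b , c) t∈ → let a∈ , b∈ , c∈ = ∈-labels⁺ t∈ in Displays-restrict eq a∈ b∈ c∈ (displays _ t∈) }
    where
    T₀≡ : leaves (node ts) ≡ keep (leaves T)
    T₀≡ = leaves-restrict-just T eq


module SameClosure (R : List Triple) (T : Tree) (idf : Identifies R T) where

  open Closure R T idf

  SameCl⇒SlotsConnected : ∀ {R″} → R″ ⊆ᵗ R → HasLeafSet T R″ → SameCl R″ R → SlotsConnected T R″
  SameCl⇒SlotsConnected {R″} R″⊆R leafSet″ sameCl us u≼T i j i≢j with lookup us i in i≡w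
  ... | leaf _  = λ _ _ ()
  ... | node ws = connected
    where
    no-cut : (S : Fin (length ws) → Bool) → Uncut S (slotGraph (node ws) (lookup us j) R″) →
             ∀ {p q} → S p ≡ true → S q ≡ false → ⊥
    no-cut S uncut Sp Sq =
      T′-not-displays-t₀ (proj₂ (sameCl t₀ ValidTriple-t₀) (Displays⇒InCl t₀ T-displays-t₀)
                           T′ IsTree-T′ leafSet′ displaysR′)
      where
      open SeparatingTree T isT R″ (λ t → displaysR t ∘ R″⊆R t) u≼T i j i≢j i≡w S uncut Sp Sq
      leafSet′ : HasLeafSet T′ R″
      leafSet′ x = proj₁ (leafSet″ x) ∘ ∈-resp-↭ leaves-T′ , ∈-resp-↭ (↭-sym leaves-T′) ∘ proj₂ (leafSet″ x)

    connected : Connected (length ws) (slotGraph (node ws) (lookup us j) R″)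
    connected S uncut p q with S p in Sp | S q in Sq
    ... | true  | true  = refl
    ... | false | false = refl
    ... | true  | false = ⊥-elim (no-cut S uncut Sp Sq)
    ... | false | true  = ⊥-elim (no-cut S uncut Sq Sp)

  -- A triple of R naming x lies in cl(R″), so the restriction of T to the labels of R″ displays it.
  SameCl⇒leaves⊆labels : ∀ {R″} → All ValidTriple R → R″ ⊆ᵗ R → SameCl R″ R → leaves T ⊆ labels R″
  SameCl⇒leaves⊆labels {R″} valid R″⊆R sameCl {x} x∈T
    with T₀ , isT₀ , leafSet₀ , displays₀ ← restriction isT R″ (anti-mono (R″⊆R _) valid) (λ t → displaysR t ∘ R″⊆R t)
    with t , t∈R , x∈t ← ∈-labels⁻ R (∈-L⁻ R (proj₁ (leafSet x) x∈T)) =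
    ∈-L⁻ R″ (proj₁ (leafSet₀ x) (Displays⇒labels⊆leaves t (inCl″ T₀ isT₀ leafSet₀ displays₀) x∈t))
    where
    inCl″ : InCl R″ t
    inCl″ = proj₂ (sameCl t (All.lookup valid t∈R)) λ _ _ _ displays′ → displays′ t t∈R


-- Slot sums

SlotFunction : Set
SlotFunction = Tree → Tree → ℕ

offDiagonal : SlotFunction → (us : List Tree) → Fin (length us) → Fin (length us) → ℕ
offDiagonal g us i j = if does (i ≟ᶠ j) then 0 else g (lookup us i) (lookup us j)

rowSum : SlotFunction → (us : List Tree) → Fin (length us) → ℕ
rowSum g us i = ∑[ j < length us ] offDiagonal g us i j

slotSum : SlotFunction → Tree → ℕ
slotSumL : SlotFunction → List Tree → ℕ
slotSum g (leaf _)  = 0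
slotSum g (node us) = ∑[ i < length us ] rowSum g us i + slotSumL g us
slotSumL g []       = 0
slotSumL g (u ∷ us) = slotSum g u + slotSumL g us

slotSum-node : ∀ g us → slotSum g (node us) ≡ ∑[ i < length us ] (rowSum g us i + slotSum g (lookup us i))
slotSum-node g us = trans (cong (∑[ i < length us ] rowSum g us i +_) (slotSumL-∑ us))
                          (sym (∑-distrib-+ (rowSum g us) (slotSum g ∘ lookup us)))
  where
  slotSumL-∑ : ∀ us → slotSumL g us ≡ ∑[ k < length us ] slotSum g (lookup us k)
  slotSumL-∑ []       = refl
  slotSumL-∑ (u ∷ us) = cong (slotSum g u +_) (slotSumL-∑ us)

SlotsAgree : SlotFunction → SlotFunction → Tree → Set
SlotsAgree f g t = ∀ {us} → node us ≼ t → ∀ i j → i ≢ j → f (lookup us i) (lookup us j) ≡ g (lookup us i) (lookup us j)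

offDiagonal-cong : ∀ {f g} us → (∀ i j → i ≢ j → f (lookup us i) (lookup us j) ≡ g (lookup us i) (lookup us j)) →
                   ∀ i j → offDiagonal f us i j ≡ offDiagonal g us i j
offDiagonal-cong us f≡g i j with i ≟ᶠ j
... | yes _   = refl
... | no i≢j  = f≡g i j i≢j

slotSum-cong : ∀ {f g} t → SlotsAgree f g t → slotSum f t ≡ slotSum g t
slotSum-cong {f} {g} = Tree-ind (λ t → SlotsAgree f g t → slotSum f t ≡ slotSum g t) (λ _ _ → refl) node-case
  where
  node-case : ∀ us → (∀ i → SlotsAgree f g (lookup us i) → slotSum f (lookup us i) ≡ slotSum g (lookup us i)) →
              SlotsAgree f g (node us) → slotSum f (node us) ≡ slotSum g (node us)
  node-case us ih agree = begin
    slotSum f (node us)                                     ≡⟨ slotSum-node f us ⟩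
    ∑[ i < length us ] (rowSum f us i + slotSum f (lookup us i))
      ≡⟨ sum-cong-≗ (λ i → cong₂ _+_ (sum-cong-≗ (offDiagonal-cong {f} {g} us (agree here) i))
                                      (ih i λ u≼ → agree (≼-trans u≼ (lookup-≼ us i)))) ⟩
    ∑[ i < length us ] (rowSum g us i + slotSum g (lookup us i)) ≡⟨ sym (slotSum-node g us) ⟩
    slotSum g (node us)                                     ∎
    where open ≡-Reasoning

slotSum-zero : ∀ {g} t → SlotsAgree g (λ _ _ → 0) t → slotSum g t ≡ 0
slotSum-zero {g} t agree =
  trans (slotSum-cong t agree) (Tree-ind (λ t → slotSum (λ _ _ → 0) t ≡ 0) (λ _ → refl) node-case t)
  where
  node-case : ∀ us → (∀ i → slotSum (λ _ _ → 0) (lookup us i) ≡ 0) → slotSum (λ _ _ → 0) (node us) ≡ 0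
  node-case us ih = trans (slotSum-node _ us)
    (sum-zero _ λ i → cong₂ _+_ (sum-zero _ λ j → if-zero (does (i ≟ᶠ j))) (ih i))
    where
    if-zero : ∀ b → (if b then 0 else 0) ≡ 0
    if-zero true  = refl
    if-zero false = refl

slotSum-+ : ∀ f g t → slotSum (λ w s → f w s + g w s) t ≡ slotSum f t + slotSum g t
slotSum-+ f g = Tree-ind (λ t → slotSum (λ w s → f w s + g w s) t ≡ slotSum f t + slotSum g t) (λ _ → refl) node-case
  where
  offDiagonal-+ : ∀ us i j → offDiagonal (λ w s → f w s + g w s) us i j ≡ offDiagonal f us i j + offDiagonal g us i j
  offDiagonal-+ us i j with does (i ≟ᶠ j)
  ... | true  = refl
  ... | false = refl
  node-case : ∀ us →
    (∀ i → slotSum (λ w s → f w s + g w s) (lookup us i) ≡ slotSum f (lookup us i) + slotSum g (lookup us i)) →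
    slotSum (λ w s → f w s + g w s) (node us) ≡ slotSum f (node us) + slotSum g (node us)
  node-case us ih = begin
    slotSum (λ w s → f w s + g w s) (node us)  ≡⟨ slotSum-node _ us ⟩
    ∑[ i < length us ] (rowSum (λ w s → f w s + g w s) us i + slotSum (λ w s → f w s + g w s) (lookup us i))
      ≡⟨ sum-cong-≗ (λ i → trans (cong₂ _+_ (trans (sum-cong-≗ (offDiagonal-+ us i))
                                               (∑-distrib-+ (offDiagonal f us i) (offDiagonal g us i))) (ih i))
                                  (+-interchange (rowSum f us i) (rowSum g us i) _ _)) ⟩
    ∑[ i < length us ] ((rowSum f us i + slotSum f (lookup us i)) + (rowSum g us i + slotSum g (lookup us i)))
      ≡⟨ ∑-distrib-+ (λ i → rowSum f us i + slotSum f (lookup us i)) (λ i → rowSum g us i + slotSum g (lookup us i)) ⟩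
    ∑[ i < length us ] (rowSum f us i + slotSum f (lookup us i))
      + ∑[ i < length us ] (rowSum g us i + slotSum g (lookup us i))
      ≡⟨ sym (cong₂ _+_ (slotSum-node f us) (slotSum-node g us)) ⟩
    slotSum f (node us) + slotSum g (node us)  ∎
    where open ≡-Reasoning

slotSum-node-single : ∀ g us k → (∀ i → i ≢ k → rowSum g us i + slotSum g (lookup us i) ≡ 0) →
                      slotSum g (node us) ≡ rowSum g us k + slotSum g (lookup us k)
slotSum-node-single g us k others = trans (slotSum-node g us) (sum-single _ k others)

innerTerm≡ : ∀ cu t → innerTerm cu t ≡ (cu ∸ 1) * (children t ∸ 1)
innerTerm≡ cu (leaf _)  = sym (*-zeroʳ (cu ∸ 1))
innerTerm≡ cu (node ts) = refl

BL-∑ : ∀ cu us → BL cu us ≡ ∑[ i < length us ] (innerTerm cu (lookup us i) + B (lookup us i))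
BL-∑ cu []       = refl
BL-∑ cu (t ∷ ts) = cong (innerTerm cu t + B t +_) (BL-∑ cu ts)

slotSum-B : ∀ t → slotSum (λ w _ → children w ∸ 1) t ≡ B t
slotSum-B = Tree-ind (λ t → slotSum gB t ≡ B t) (λ _ → refl) node-case
  where
  gB : SlotFunction
  gB w _ = children w ∸ 1
  node-case : ∀ us → (∀ i → slotSum gB (lookup us i) ≡ B (lookup us i)) → slotSum gB (node us) ≡ B (node us)
  node-case us ih = begin
    slotSum gB (node us)                                          ≡⟨ slotSum-node gB us ⟩
    ∑[ i < length us ] (rowSum gB us i + slotSum gB (lookup us i))
      ≡⟨ sum-cong-≗ (λ i → cong₂ _+_ (trans (sum-skip i (children (lookup us i) ∸ 1))
                                            (sym (innerTerm≡ (length us) (lookup us i)))) (ih i)) ⟩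
    ∑[ i < length us ] (innerTerm (length us) (lookup us i) + B (lookup us i))  ≡⟨ sym (BL-∑ (length us) us) ⟩
    B (node us)                                                   ∎
    where open ≡-Reasoning

indicator : Triple → SlotFunction
indicator t w s with slotEdge w s t
... | just _  = 1
... | nothing = 0

length-slotGraph-∷ : ∀ w s t R → length (slotGraph w s (t ∷ R)) ≡ indicator t w s + length (slotGraph w s R)
length-slotGraph-∷ w s t R with slotEdge w s t
... | just _  = refl
... | nothing = refl

indicator-0 : ∀ {a b c} w s → a ∉ leaves w ⊎ c ∉ leaves s → indicator (a , b , c) w s ≡ 0
indicator-0 {a} {b} {c} w s outside with slotEdge w s (a , b , c) in eq
... | nothing = refl
... | just _  with a∈w , c∈s ← slotEdge-just⇒∈ w s a b c eq | outside
...   | inj₁ a∉w = ⊥-elim (a∉w a∈w)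
...   | inj₂ c∉s = ⊥-elim (c∉s c∈s)

indicator-1 : ∀ {a b c} w s → a ≢ b → Unique (leaves w) → a ∈ leaves w → b ∈ leaves w → c ∈ leaves s →
              indicator (a , b , c) w s ≡ 1
indicator-1 (leaf y) _ a≢b _ (here refl) (here refl) _ = ⊥-elim (a≢b refl)
indicator-1 {a} {b} {c} (node ws) s _ uniq a∈w b∈w c∈s
  with p , a∈p ← ∈-leavesL⁻ ws a∈w | q , b∈q ← ∈-leavesL⁻ ws b∈w
  rewrite slotEdge-just⁺ (node ws) s a b c uniq c∈s a∈p b∈q = refl

offDiagonal-indicator-0 : ∀ {a b c} us i j → a ∉ leaves (lookup us i) ⊎ c ∉ leaves (lookup us j) →
                          offDiagonal (indicator (a , b , c)) us i j ≡ 0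
offDiagonal-indicator-0 us i j outside with does (i ≟ᶠ j)
... | true  = refl
... | false = indicator-0 (lookup us i) (lookup us j) outside

slotSum-indicator-outside : ∀ {a b c} u → a ∉ leaves u ⊎ c ∉ leaves u → slotSum (indicator (a , b , c)) u ≡ 0
slotSum-indicator-outside u outside =
  slotSum-zero u λ {us} u′≼u i j _ → indicator-0 (lookup us i) (lookup us j) (inside u′≼u i j outside)
  where
  inside : ∀ {us a c} → node us ≼ u → ∀ i j → a ∉ leaves u ⊎ c ∉ leaves u →
           a ∉ leaves (lookup us i) ⊎ c ∉ leaves (lookup us j)
  inside {us} u′≼u i j (inj₁ a∉u) = inj₁ (a∉u ∘ ≼-leaves (≼-trans (lookup-≼ us i) u′≼u))
  inside {us} u′≼u i j (inj₂ c∉u) = inj₂ (c∉u ∘ ≼-leaves (≼-trans (lookup-≼ us j) u′≼u))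

-- The only slot with an edge for ab|c is the pair of children of lca(a, b, c) containing a and c.
slotSum-indicator-displayed : ∀ {a b c} → a ≢ b → ∀ u → Unique (leaves u) → Displays u (a , b , c) →
                              slotSum (indicator (a , b , c)) u ≡ 1
slotSum-indicator-displayed {a} {b} {c} a≢b = Tree-ind P leaf-case node-case
  where
  P : Tree → Set
  P u = Unique (leaves u) → Displays u (a , b , c) → slotSum (indicator (a , b , c)) u ≡ 1

  leaf-case : ∀ x → P (leaf x)
  leaf-case x _ (here refl , here refl , _) = ⊥-elim (a≢b refl)

  node-case : ∀ us → (∀ i → P (lookup us i)) → P (node us)
  node-case us ih uniq (a∈u , b∈u , c∈u , v , v≼u , a∈v , b∈v , c∉v) with ≼-node⁻ v≼u
  ... | inj₁ refl      = ⊥-elim (c∉v c∈u)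
  ... | inj₂ (k , v≼k) = trans (slotSum-node-single _ us k others) (at-k (k ≟ᶠ ic))
    where
    a∈k : a ∈ leaves (lookup us k)
    a∈k = ≼-leaves v≼k a∈v
    index≡ : ∀ {i j x} → x ∈ leaves (lookup us i) → x ∈ leaves (lookup us j) → i ≡ j
    index≡ = Unique-leavesL⇒index≡ us uniq
    a∉ : ∀ {i} → i ≢ k → a ∉ leaves (lookup us i)
    a∉ i≢k a∈i = i≢k (index≡ a∈i a∈k)
    others : ∀ i → i ≢ k → rowSum (indicator (a , b , c)) us i + slotSum (indicator (a , b , c)) (lookup us i) ≡ 0
    others i i≢k = cong₂ _+_ (sum-zero _ λ j → offDiagonal-indicator-0 us i j (inj₁ (a∉ i≢k)))
                             (slotSum-indicator-outside (lookup us i) (inj₁ (a∉ i≢k)))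
    ic : Fin (length us)
    ic = proj₁ (∈-leavesL⁻ us c∈u)
    c∈ic : c ∈ leaves (lookup us ic)
    c∈ic = proj₂ (∈-leavesL⁻ us c∈u)
    c∉ : ∀ {j} → j ≢ ic → c ∉ leaves (lookup us j)
    c∉ j≢ic c∈j = j≢ic (index≡ c∈j c∈ic)
    at-k : Dec (k ≡ ic) → rowSum (indicator (a , b , c)) us k + slotSum (indicator (a , b , c)) (lookup us k) ≡ 1
    at-k (yes refl) = cong₂ _+_ (sum-zero _ row-zero)
                        (ih k (≼-Unique (lookup-≼ us k) uniq) (a∈k , ≼-leaves v≼k b∈v , c∈ic , v , v≼k , a∈v , b∈v , c∉v))
      where
      row-zero : ∀ j → offDiagonal (indicator (a , b , c)) us k j ≡ 0
      row-zero j with k ≟ᶠ j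
      ... | yes _   = refl
      ... | no k≢j  = indicator-0 (lookup us k) (lookup us j) (inj₂ (c∉ (k≢j ∘ sym)))
    at-k (no k≢ic) = cong₂ _+_ (trans (sum-single _ ic λ j j≢ic → offDiagonal-indicator-0 us k j (inj₂ (c∉ j≢ic))) edge)
                       (slotSum-indicator-outside (lookup us k) (inj₂ (c∉ k≢ic)))
      where
      edge : offDiagonal (indicator (a , b , c)) us k ic ≡ 1
      edge with k ≟ᶠ ic
      ... | yes k≡ic = ⊥-elim (k≢ic k≡ic)
      ... | no _     = indicator-1 (lookup us k) (lookup us ic) a≢b (≼-Unique (lookup-≼ us k) uniq)
                                    a∈k (≼-leaves v≼k b∈v) c∈ic

length≡slotSum : ∀ T → Unique (leaves T) → ∀ R → All ValidTriple R → DisplaysAll T R →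
                 length R ≡ slotSum (λ w s → length (slotGraph w s R)) T
length≡slotSum T uniq [] _ _ = sym (slotSum-zero T λ _ _ _ _ → refl)
length≡slotSum T uniq ((a , b , c) ∷ R) ((a<b , _) ∷ valid) displays = begin
  1 + length R
    ≡⟨ cong₂ _+_ (sym (slotSum-indicator-displayed (<⇒≢ a<b) T uniq (displays _ (here refl))))
                 (length≡slotSum T uniq R valid (λ t → displays t ∘ there)) ⟩
  slotSum (indicator (a , b , c)) T + slotSum (λ w s → length (slotGraph w s R)) T
    ≡⟨ sym (slotSum-+ (indicator (a , b , c)) (λ w s → length (slotGraph w s R)) T) ⟩
  slotSum (λ w s → indicator (a , b , c) w s + length (slotGraph w s R)) T
    ≡⟨ slotSum-cong T (λ {us} _ i j _ → sym (length-slotGraph-∷ (lookup us i) (lookup us j) (a , b , c) R)) ⟩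
  slotSum (λ w s → length (slotGraph w s ((a , b , c) ∷ R))) T ∎
  where open ≡-Reasoning


-- The quadratic bound

leafCount : Tree → ℕ
leafCount t = length (leaves t)

children≤leaves : ∀ {ts} → All NonRootWF ts → length ts ≤ length (leavesL ts)
children≤leaves []                  = z≤n
children≤leaves {t ∷ ts} (wf ∷ wfs) = subst (suc (length ts) ≤_) (sym (length-++ (leaves t)))
  (+-mono-≤ (∈⇒1≤length (proj₂ (NonRootWF⇒leaf wf))) (children≤leaves wfs))

children∸1≤leafCount : ∀ {t} → NonRootWF t → children t ∸ 1 ≤ leafCount t
children∸1≤leafCount (leafWF _)        = z≤n
children∸1≤leafCount (nodeWF ts _ wfs) = ≤-trans (m∸n≤m (length ts) 1) (children≤leaves wfs)

siblings+leafCount≤ : ∀ {us t} → All NonRootWF us → t ∈ us → (length us ∸ 1) + leafCount t ≤ length (leavesL us)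
siblings+leafCount≤ {us} {t} wfs t∈ with rest , us↭ ← ∈⇒↭∷ t∈ with _ ∷ wfs′ ← All-resp-↭ us↭ wfs = begin
  (length us ∸ 1) + leafCount t              ≡⟨ cong (λ n → n ∸ 1 + leafCount t) (↭-length us↭) ⟩
  length rest + leafCount t                  ≤⟨ +-monoˡ-≤ (leafCount t) (children≤leaves wfs′) ⟩
  length (leavesL rest) + leafCount t        ≡⟨ +-comm (length (leavesL rest)) (leafCount t) ⟩
  leafCount t + length (leavesL rest)        ≡⟨ sym (length-++ (leaves t)) ⟩
  length (leavesL (t ∷ rest))                ≡⟨ sym (↭-length (leavesL-↭ us↭)) ⟩
  length (leavesL us)                        ∎
  where open ≤-Reasoning

B≤leafCount² : ∀ {t} → NonRootWF t → B t ≤ leafCount t * leafCount t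
BL≤ : ∀ cu n {us} → All NonRootWF us → All (λ t → (cu ∸ 1) + leafCount t ≤ n) us → BL cu us ≤ n * length (leavesL us)
B≤leafCount² (leafWF _)         = z≤n
B≤leafCount² (nodeWF us _ wfs)  = BL≤ (length us) (length (leavesL us)) wfs (All.tabulate (siblings+leafCount≤ wfs))
BL≤ cu n []                     []               = z≤n
BL≤ cu n {t ∷ ts} (wf ∷ wfs) (bound ∷ bounds) = begin
  innerTerm cu t + B t + BL cu ts                       ≤⟨ +-mono-≤ child (BL≤ cu n wfs bounds) ⟩
  n * leafCount t + n * length (leavesL ts)             ≡⟨ sym (*-distribˡ-+ n (leafCount t) _) ⟩
  n * (leafCount t + length (leavesL ts))               ≡⟨ cong (n *_) (sym (length-++ (leaves t))) ⟩
  n * length (leavesL (t ∷ ts))                         ∎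
  where
  open ≤-Reasoning
  child : innerTerm cu t + B t ≤ n * leafCount t
  child = begin
    innerTerm cu t + B t                                ≡⟨ cong (_+ B t) (innerTerm≡ cu t) ⟩
    (cu ∸ 1) * (children t ∸ 1) + B t
      ≤⟨ +-mono-≤ (*-monoʳ-≤ (cu ∸ 1) (children∸1≤leafCount wf)) (B≤leafCount² wf) ⟩
    (cu ∸ 1) * leafCount t + leafCount t * leafCount t  ≡⟨ sym (*-distribʳ-+ (leafCount t) (cu ∸ 1) (leafCount t)) ⟩
    ((cu ∸ 1) + leafCount t) * leafCount t              ≤⟨ *-monoˡ-≤ (leafCount t) bound ⟩
    n * leafCount t                                     ∎

B≤leafCount²-IsTree : ∀ {T} → IsTree T → B T ≤ leafCount T * leafCount T
B≤leafCount²-IsTree isT with IsTree⇒empty⊎NonRootWF isT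
... | inj₁ refl = z≤n
... | inj₂ wf   = B≤leafCount² wf

leafCount≡length-L : ∀ {T R} → IsTree T → HasLeafSet T R → leafCount T ≡ length (L R)
leafCount≡length-L {R = R} isT leafSet =
  ≤-antisym (Unique-⊆⇒length≤ (IsTree-Unique isT here) (proj₁ (leafSet _)))
            (Unique-⊆⇒length≤ (deduplicate-! (labels R)) (proj₂ (leafSet _)))

B≤|L|² : ∀ {T R} → Identifies R T → B T ≤ length (L R) * length (L R)
B≤|L|² (isT , leafSet , _) = subst (λ n → _ ≤ n * n) (leafCount≡length-L isT leafSet) (B≤leafCount²-IsTree isT)


module MinimalSubset (R : List Triple) (T : Tree) (triples : TripleSet R) (idf : Identifies R T)
                     (R′ : List Triple) (minimal : MinimalClosureSubset R R′) where

  open Closure R T idf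
  open SameClosure R T idf

  R′⊆R : R′ ⊆ᵗ R
  R′⊆R = proj₁ (proj₂ minimal)

  sameCl′ : SameCl R′ R
  sameCl′ = proj₁ (proj₂ (proj₂ minimal))

  slotsConnected′ : SlotsConnected T R′
  slotsConnected′ =
    SameCl⇒SlotsConnected R′⊆R (HasLeafSet-⊆ R′⊆R (SameCl⇒leaves⊆labels (proj₁ triples) R′⊆R sameCl′)) sameCl′

  -- Dropping the triple behind the edge e leaves every other slot graph unchanged (slot-unique), so
  -- if the slot stayed connected the smaller set would keep the closure, contradicting minimality.
  slot-essential : ∀ us → node us ≼ T → ∀ i j → i ≢ j → ∀ ys e zs →
    slotGraph (lookup us i) (lookup us j) R′ ≡ ys ++ e ∷ zs → ¬ Connected _ (ys ++ zs)
  slot-essential us u≼T i j i≢j ys e zs split conn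
    with xs₁ , xs₂ , (a , b , c) , R′≡ , refl , te , refl
           ← mapMaybe-split (slotEdge (lookup us i) (lookup us j)) R′ ys e zs split =
    Unique[x∷xs]⇒x∉xs (Unique-resp-↭ (shift _ xs₁ xs₂) (subst Unique R′≡ (proj₁ minimal)))
      (proj₂ (proj₂ (proj₂ minimal)) R″ R″⊆R′ sameCl″ _ t∈R′)
    where
    R″ : List Triple
    R″ = xs₁ ++ xs₂

    t∈R′ : (a , b , c) ∈ R′
    t∈R′ = subst (_ ∈_) (sym R′≡) (∈-++⁺ʳ xs₁ (here refl))

    R″⊆R′ : R″ ⊆ᵗ R′
    R″⊆R′ t t∈ with ∈-++⁻ xs₁ t∈
    ... | inj₁ t∈₁ = subst (t ∈_) (sym R′≡) (∈-++⁺ˡ t∈₁)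
    ... | inj₂ t∈₂ = subst (t ∈_) (sym R′≡) (∈-++⁺ʳ xs₁ (there t∈₂))

    slotsConnected″ : SlotsConnected T R″
    slotsConnected″ us₂ u₂≼T i₂ j₂ i₂≢j₂ with slotEdge (lookup us₂ i₂) (lookup us₂ j₂) (a , b , c) in te₂
    ... | nothing = subst (Connected _) (trans (cong (slotGraph (lookup us₂ i₂) (lookup us₂ j₂)) R′≡)
                                              (mapMaybe-drop (slotEdge (lookup us₂ i₂) (lookup us₂ j₂)) xs₁ xs₂ te₂))
                      (slotsConnected′ us₂ u₂≼T i₂ j₂ i₂≢j₂)
    ... | just _ with i≡ , j≡ ← slot-unique isT u≼T u₂≼T i≢j i₂≢j₂ (a , b , c) te te₂ =
      subst₂ (λ w s → Connected (length (childList w)) (slotGraph w s R″)) (sym i≡) (sym j≡)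
        (subst (Connected _) (sym (mapMaybe-++ (slotEdge (lookup us i) (lookup us j)) xs₁ xs₂)) conn)

    a≢b : a ≢ b
    a≢b = <⇒≢ (proj₁ (All.lookup (proj₁ triples) (R′⊆R _ t∈R′)))

    leaves⊆labels″ : leaves T ⊆ labels R″
    leaves⊆labels″ with us₀ , T≡ , _ ← isT =
      Coverage.leaves⊆labels T isT R″ slotsConnected″ T≡
        (Displays⇒InnerChild us₀ a≢b (subst (λ T → Displays T (a , b , c)) T≡ (displaysR _ (R′⊆R _ t∈R′))))

    sameCl″ : SameCl R″ R
    sameCl″ = SlotsConnected⇒SameCl (λ t → R′⊆R t ∘ R″⊆R′ t) slotsConnected″ leaves⊆labels″

  slot-length : SlotsAgree (λ w s → length (slotGraph w s R′)) (λ w _ → children w ∸ 1) T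
  slot-length {us} u≼T i j i≢j =
    trans (MinimallyConnected⇒length≡ _ _ (slotsConnected′ us u≼T i j i≢j , slot-essential us u≼T i j i≢j))
          (cong (_∸ 1) (sym (children≡ (lookup us i))))

  length≡B : length R′ ≡ B T
  length≡B = begin
    length R′
      ≡⟨ length≡slotSum T (IsTree-Unique isT here) R′ (anti-mono (R′⊆R _) (proj₁ triples)) (λ t → displaysR t ∘ R′⊆R t) ⟩
    slotSum (λ w s → length (slotGraph w s R′)) T       ≡⟨ slotSum-cong T slot-length ⟩
    slotSum (λ w _ → children w ∸ 1) T                  ≡⟨ slotSum-B T ⟩
    B T                                                 ∎
    where open ≡-Reasoning

mainTheorem17 : Σ ℕ λ k → ∀ (R : List Triple) (T : Tree) → TripleSet R → Identifies R T →
    ∀ (R' : List Triple) → MinimalClosureSubset R R' →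
    (length R' ≡ B T) × (B T ≤ k * (length (L R) * length (L R)))
mainTheorem17 = 1 , λ R T triples idf R′ minimal →
  MinimalSubset.length≡B R T triples idf R′ minimal , subst (B T ≤_) (sym (*-identityˡ _)) (B≤|L|² idf)
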